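{- For indeterminates $u,y,a,b,c,q$ and every integer $n\ge 0$, \begin{align*} \prod_{i=1}^n (uq^{i-1}-y)(c-uq^{i-1}y) &=q^{\binom n2}\sum_{k=0}^n {n \brack k}\frac{P_{n-k}(b,uq^{n-1})P_k(a,uq^{n-k})P_{n-k}(u,c/b)P_{k}(c/a,u)}{P_n(b,a)\,(cq^{n-k-1}/ab;q)_{n-k}\,(cq^{2n-2k}/ab;q)_k}\\ &\quad\times P_{n-k}(y,aq^{k+1-n})P_{n-k}(y,c/a)P_{k}(y,bq^{1-n})P_{k}(y,cq^{n-k}/b). \end{align*}
   Context: $(x;q)_0=1$ and $(x;q)_m=(1-x)(1-xq)\cdots(1-xq^{m-1})$ for $m\ge1$. The Cauchy polynomial is $P_m(x,z)=x^m(z/x;q)_m$. The $q$-binomial coefficient is ${n\brack k}=\frac{(q;q)_n}{(q;q)_k(q;q)_{n-k}}$. -}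

module Defs where

open import Level using (Level; _⊔_) renaming (suc to lsuc)
open import Data.Nat using (ℕ; zero; suc; _∸_)
open import Data.Integer using (ℤ; +_; -[1+_])
open import Relation.Nullary using (¬_)
open import Algebra.Bundles using (CommutativeRing)

-- A (commutative) field: a commutative ring with 0 ≠ 1 and a total
-- inverse function which is a genuine inverse on nonzero elements
-- (the value of 0⁻¹ is unspecified and never used below, since every
-- division in the statement is guarded by a nonzero hypothesis).
record Field (c ℓ : Level) : Set (lsuc (c ⊔ ℓ)) where
  field
    commutativeRing : CommutativeRing c ℓ
  open CommutativeRing commutativeRing public
  field
    _⁻¹      : Carrier → Carrier
    ⁻¹-cong  : ∀ {x y} → x ≈ y → x ⁻¹ ≈ y ⁻¹
    0≉1      : ¬ (0# ≈ 1#)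
    inverseʳ : ∀ x → ¬ (x ≈ 0#) → x * (x ⁻¹) ≈ 1#

module FieldOps {c ℓ : Level} (F : Field c ℓ) where
  open Field F using (Carrier; _+_; _*_; _-_; 0#; 1#; _⁻¹)

  infixl 7 _/_
  _/_ : Carrier → Carrier → Carrier
  x / y = x * (y ⁻¹)

  infixr 8 _^_
  _^_ : Carrier → ℕ → Carrier
  x ^ zero  = 1#
  x ^ suc m = x * (x ^ m)

  infixr 8 _^ℤ_
  _^ℤ_ : Carrier → ℤ → Carrier
  x ^ℤ (+ m)      = x ^ m
  x ^ℤ (-[1+ m ]) = (x ^ suc m) ⁻¹

  -- q-shifted factorial (x;q)_m = (1-x)(1-xq)...(1-xq^{m-1})
  poch : Carrier → Carrier → ℕ → Carrier
  poch q x zero    = 1#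
  poch q x (suc m) = poch q x m * (1# - x * q ^ m)

  -- Cauchy polynomial P_m(x,z) = x^m (z/x;q)_m
  P : Carrier → ℕ → Carrier → Carrier → Carrier
  P q m x z = x ^ m * poch q (z / x) m

  qbinom : Carrier → ℕ → ℕ → Carrier
  qbinom q n k = poch q q n / (poch q q k * poch q q (n ∸ k))

  sumTo : ℕ → (ℕ → Carrier) → Carrier
  sumTo zero    f = f zero
  sumTo (suc n) f = sumTo n f + f (suc n)

  prod1To : ℕ → (ℕ → Carrier) → Carrier
  prod1To zero    f = 1#
  prod1To (suc n) f = prod1To n f * f (suc n)

module FieldNotation {c ℓ : Level} (F : Field c ℓ) where
  open Field F public using (Carrier; _≈_; _+_; _*_; _-_; 0#; 1#)
  open FieldOps F public

-- Induct on n, replacing b by b/q. Write the k-th summand (m = n - k) as a y-free coefficient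
-- coeff(m,k;b) times basis(m,k;b) = P_m(y,aq^(1-m)) P_m(y,c/a) P_k(y,bq^(1-n)) P_k(y,cq^m/b).
-- Passing from b/q to b, raising m resp. k multiplies the basis element by the quadratic
-- φ_x(y) = (y - x)(y - c/x) with x = a/q^m resp. x = b/q^m. The new factor (uq^n - y)(c - uq^n y)
-- of the product is a multiple of φ_x for x = uq^n, and any three such quadratics are linearly
-- dependent, so it is a combination wA φ_A + wB φ_B. Multiplying the sum for n by it and
-- regrouping Pascal-style gives q^n times the sum for n + 1, because the coefficients satisfy
--   q^n coeff(m+1,k+1;b) = wA coeff(m,k+1;b/q) + wB coeff(m+1,k;b/q)
-- (with one-term versions at the two ends), a polynomial identity once common factors cancel.
module Submission where

open import Defs
open import Level using (Level)
open import Data.Nat using (ℕ; _≤_; _∸_) renaming (_*_ to _*ℕ_; _+_ to _+ℕ_)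
open import Data.Nat.Combinatorics using (_C_; nC1≡n; nCk+nC[k+1]≡[n+1]C[k+1])
open import Data.Integer using (+_) renaming (_-_ to _-ℤ_)
open import Relation.Nullary using (¬_)

open import Algebra.Bundles using (CommutativeRing)
open import Algebra.Solver.Ring.AlmostCommutativeRing
  using (_-Raw-AlmostCommutative⟶_; fromCommutativeRing)
open import Data.Nat as ℕ using (zero; suc; z≤n; s≤s)
import Data.Nat.Properties as ℕ
open import Data.Integer as ℤ using (ℤ; -[1+_]; _⊖_; _◃_; sign; ∣_∣)
import Data.Integer.Properties as ℤ
open import Data.Sign as Sign using (Sign)
open import Data.Maybe.Base using (Maybe; just; nothing)
open import Relation.Nullary.Decidable using (yes; no)
open import Relation.Binary.PropositionalEquality as ≡ using (_≡_)

-- The library's solver for an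
-- abstract commutative ring takes its coefficients from the ring itself,
-- where it cannot decide that a coefficient such as 1 - 1 vanishes.
module IntegerCoefficients {c ℓ : Level} (R : CommutativeRing c ℓ) where
  open CommutativeRing R
  open import Algebra.Properties.Monoid.Mult.TCOptimised +-monoid using (_×_; ×-homo-+)
  open import Algebra.Properties.Semiring.Mult.TCOptimised semiring using (×1-homo-*)
  open import Algebra.Properties.Ring ring using (-‿involutive; -0#≈0#; -‿+-comm; -1*x≈-x)
  open import Algebra.Properties.CommutativeSemigroup +-commutativeSemigroup
    using () renaming (interchange to +-interchange)
  open import Algebra.Properties.CommutativeSemigroup *-commutativeSemigroup
    using () renaming (interchange to *-interchange)
  open import Relation.Binary.Reasoning.Setoid setoid

  fromℤ : ℤ → Carrier
  fromℤ (+ n)     = n × 1#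
  fromℤ -[1+ n ] = - (suc n × 1#)

  private
    [1+x]-[1+y]≈x-y : ∀ x y → (1# + x) - (1# + y) ≈ x - y
    [1+x]-[1+y]≈x-y x y = begin
      (1# + x) - (1# + y)      ≈⟨ +-congˡ (-‿+-comm 1# y) ⟨
      (1# + x) + (- 1# + - y)  ≈⟨ +-interchange 1# x (- 1#) (- y) ⟩
      (1# - 1#) + (x - y)      ≈⟨ +-congʳ (-‿inverseʳ 1#) ⟩
      0# + (x - y)             ≈⟨ +-identityˡ (x - y) ⟩
      x - y                    ∎

    x-0≈x : ∀ x → x - 0# ≈ x
    x-0≈x x = trans (+-congˡ -0#≈0#) (+-identityʳ x)

    ⊖-homo : ∀ m n → fromℤ (m ⊖ n) ≈ m × 1# - n × 1#
    ⊖-homo zero    zero    = sym (x-0≈x 0#)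
    ⊖-homo (suc m) zero    = sym (x-0≈x (suc m × 1#))
    ⊖-homo zero    (suc n) = sym (+-identityˡ _)
    ⊖-homo (suc m) (suc n) = begin
      fromℤ (suc m ⊖ suc n)          ≡⟨ ≡.cong fromℤ (ℤ.[1+m]⊖[1+n]≡m⊖n m n) ⟩
      fromℤ (m ⊖ n)                  ≈⟨ ⊖-homo m n ⟩
      m × 1# - n × 1#                ≈⟨ [1+x]-[1+y]≈x-y _ _ ⟨
      (1# + m × 1#) - (1# + n × 1#)  ≈⟨ +-cong (×-homo-+ 1# 1 m) (-‿cong (×-homo-+ 1# 1 n)) ⟨
      suc m × 1# - suc n × 1#        ∎

    +-homo : ∀ i j → fromℤ (i ℤ.+ j) ≈ fromℤ i + fromℤ j
    +-homo (+ m)     (+ n)     = ×-homo-+ 1# m n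
    +-homo (+ m)     -[1+ n ] = ⊖-homo m (suc n)
    +-homo -[1+ m ] (+ n)     = trans (⊖-homo n (suc m)) (+-comm _ _)
    +-homo -[1+ m ] -[1+ n ] = begin
      - (suc (suc (m ℕ.+ n)) × 1#)     ≡⟨ ≡.cong (λ k → - (suc k × 1#)) (ℕ.+-suc m n) ⟨
      - ((suc m ℕ.+ suc n) × 1#)       ≈⟨ -‿cong (×-homo-+ 1# (suc m) (suc n)) ⟩
      - (suc m × 1# + suc n × 1#)      ≈⟨ -‿+-comm _ _ ⟨
      - (suc m × 1#) + - (suc n × 1#)  ∎

    -‿homo : ∀ i → fromℤ (ℤ.- i) ≈ - fromℤ i
    -‿homo (+ zero)  = sym -0#≈0#
    -‿homo (+ suc n) = refl
    -‿homo -[1+ n ] = sym (-‿involutive _)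

    fromSign : Sign → Carrier
    fromSign Sign.+ = 1#
    fromSign Sign.- = - 1#

    fromSign-homo : ∀ s t → fromSign (s Sign.* t) ≈ fromSign s * fromSign t
    fromSign-homo Sign.+ t      = sym (*-identityˡ _)
    fromSign-homo Sign.- Sign.+ = sym (*-identityʳ _)
    fromSign-homo Sign.- Sign.- = sym (trans (-1*x≈-x (- 1#)) (-‿involutive 1#))

    ◃-homo : ∀ s n → fromℤ (s ◃ n) ≈ fromSign s * (n × 1#)
    ◃-homo s       zero    = sym (zeroʳ _)
    ◃-homo Sign.+ (suc n) = sym (*-identityˡ _)
    ◃-homo Sign.- (suc n) = sym (-1*x≈-x _)

    fromℤ-signAbs : ∀ i → fromℤ i ≈ fromSign (sign i) * (∣ i ∣ × 1#)
    fromℤ-signAbs i = trans (reflexive (≡.cong fromℤ (≡.sym (ℤ.◃-inverse i)))) (◃-homo (sign i) ∣ i ∣)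

    *-homo : ∀ i j → fromℤ (i ℤ.* j) ≈ fromℤ i * fromℤ j
    *-homo i j = begin
      fromℤ (sign i Sign.* sign j ◃ ∣ i ∣ ℕ.* ∣ j ∣)
        ≈⟨ ◃-homo (sign i Sign.* sign j) (∣ i ∣ ℕ.* ∣ j ∣) ⟩
      fromSign (sign i Sign.* sign j) * ((∣ i ∣ ℕ.* ∣ j ∣) × 1#)
        ≈⟨ *-cong (fromSign-homo (sign i) (sign j)) (×1-homo-* ∣ i ∣ ∣ j ∣) ⟩
      (fromSign (sign i) * fromSign (sign j)) * ((∣ i ∣ × 1#) * (∣ j ∣ × 1#))
        ≈⟨ *-interchange _ _ _ _ ⟩
      (fromSign (sign i) * (∣ i ∣ × 1#)) * (fromSign (sign j) * (∣ j ∣ × 1#))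
        ≈⟨ *-cong (fromℤ-signAbs i) (fromℤ-signAbs j) ⟨
      fromℤ i * fromℤ j ∎

  fromℤ-morphism : ℤ.+-*-rawRing -Raw-AlmostCommutative⟶ fromCommutativeRing R
  fromℤ-morphism = record
    { ⟦_⟧    = fromℤ
    ; +-homo = +-homo
    ; *-homo = *-homo
    ; -‿homo = -‿homo
    ; 0-homo = refl
    ; 1-homo = refl
    }

  fromℤ-≡ : ∀ i j → Maybe (fromℤ i ≈ fromℤ j)
  fromℤ-≡ i j with i ℤ.≟ j
  ... | yes ≡.refl = just refl
  ... | no  _      = nothing

  open import Algebra.Solver.Ring ℤ.+-*-rawRing (fromCommutativeRing R) fromℤ-morphism fromℤ-≡ public
    using (solve; _:=_; _:+_; _:*_; _:-_; :-_; con)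

module FieldProperties {ℓ₁ ℓ₂ : Level} (F : Field ℓ₁ ℓ₂) where
  open Field F
  open FieldOps F
  open IntegerCoefficients commutativeRing
  open import Relation.Binary.Reasoning.Setoid setoid

  inverseˡ : ∀ x → x ≉ 0# → x ⁻¹ * x ≈ 1#
  inverseˡ x x≉0 = trans (*-comm _ _) (inverseʳ x x≉0)

  1≉0 : 1# ≉ 0#
  1≉0 1≈0 = 0≉1 (sym 1≈0)

  ≉0-resp-≈ : ∀ {x y} → x ≈ y → x ≉ 0# → y ≉ 0#
  ≉0-resp-≈ x≈y x≉0 y≈0 = x≉0 (trans x≈y y≈0)

  *-≉0ˡ : ∀ {x y} → x * y ≉ 0# → x ≉ 0#
  *-≉0ˡ {x} {y} xy≉0 x≈0 = xy≉0 (trans (*-congʳ x≈0) (zeroˡ y))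

  *-≉0ʳ : ∀ {x y} → x * y ≉ 0# → y ≉ 0#
  *-≉0ʳ {x} {y} xy≉0 y≈0 = xy≉0 (trans (*-congˡ y≈0) (zeroʳ x))

  *-/-cancel : ∀ {x} y → x ≉ 0# → y * x / x ≈ y
  *-/-cancel {x} y x≉0 = begin
    y * x * x ⁻¹    ≈⟨ *-assoc y x _ ⟩
    y * (x * x ⁻¹)  ≈⟨ *-congˡ (inverseʳ x x≉0) ⟩
    y * 1#          ≈⟨ *-identityʳ y ⟩
    y               ∎

  /-*-cancel : ∀ {x} y → x ≉ 0# → y / x * x ≈ y
  /-*-cancel {x} y x≉0 = trans (solve 3 (λ y i x → y :* i :* x := y :* x :* i) refl y _ x) (*-/-cancel y x≉0)

  *-cancelʳ : ∀ {x y d} → d ≉ 0# → x * d ≈ y * d → x ≈ y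
  *-cancelʳ {x} {y} {d} d≉0 xd≈yd = begin
    x              ≈⟨ *-/-cancel x d≉0 ⟨
    x * d / d      ≈⟨ *-congʳ xd≈yd ⟩
    y * d / d      ≈⟨ *-/-cancel y d≉0 ⟩
    y              ∎

  *-≉0 : ∀ {x y} → x ≉ 0# → y ≉ 0# → x * y ≉ 0#
  *-≉0 {x} {y} x≉0 y≉0 xy≈0 = x≉0 (*-cancelʳ y≉0 (trans xy≈0 (sym (zeroˡ y))))

  ⁻¹-≉0 : ∀ {x} → x ≉ 0# → x ⁻¹ ≉ 0#
  ⁻¹-≉0 {x} x≉0 x⁻¹≈0 = 0≉1 (trans (sym (zeroʳ x)) (trans (*-congˡ (sym x⁻¹≈0)) (inverseʳ x x≉0)))

  ^-≉0 : ∀ {x} m → x ≉ 0# → x ^ m ≉ 0#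
  ^-≉0 zero    x≉0 = 1≉0
  ^-≉0 (suc m) x≉0 = *-≉0 x≉0 (^-≉0 m x≉0)

  x-y≉0⇒y-x≉0 : ∀ {x y} → x - y ≉ 0# → y - x ≉ 0#
  x-y≉0⇒y-x≉0 {x} {y} x-y≉0 y-x≈0 = x-y≉0 (begin
    x - y      ≈⟨ solve 2 (λ x y → x :- y := :- (y :- x)) refl x y ⟩
    - (y - x)  ≈⟨ -‿cong y-x≈0 ⟩
    - 0#       ≈⟨ solve 0 (:- con (+ 0) := con (+ 0)) refl ⟩
    0#         ∎)

  *⇒/ : ∀ {x y z} → x ≉ 0# → z * x ≈ y → z ≈ y / x
  *⇒/ {x} {y} {z} x≉0 zx≈y = *-cancelʳ x≉0 (trans zx≈y (sym (/-*-cancel y x≉0)))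

  ⁻¹-*-distrib : ∀ {x y} → x ≉ 0# → y ≉ 0# → (x * y) ⁻¹ ≈ x ⁻¹ * y ⁻¹
  ⁻¹-*-distrib {x} {y} x≉0 y≉0 = *-cancelʳ (*-≉0 x≉0 y≉0) (begin
    (x * y) ⁻¹ * (x * y)        ≈⟨ inverseˡ (x * y) (*-≉0 x≉0 y≉0) ⟩
    1#                          ≈⟨ *-identityʳ 1# ⟨
    1# * 1#                     ≈⟨ *-cong (inverseˡ x x≉0) (inverseˡ y y≉0) ⟨
    (x ⁻¹ * x) * (y ⁻¹ * y)     ≈⟨ solve 4 (λ a b c d → (a :* b) :* (c :* d) := (a :* c) :* (b :* d)) refl _ _ _ _ ⟩
    (x ⁻¹ * y ⁻¹) * (x * y)     ∎)

  1⁻¹≈1 : 1# ⁻¹ ≈ 1#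
  1⁻¹≈1 = trans (sym (*-identityˡ _)) (inverseʳ 1# 1≉0)

  1/1≈1 : ∀ {x y} → x ≈ 1# → y ≈ 1# → x / y ≈ 1#
  1/1≈1 x≈1 y≈1 = trans (*-cong x≈1 (trans (⁻¹-cong y≈1) 1⁻¹≈1)) (*-identityʳ 1#)

  /-*-/ : ∀ {a b c d} → b ≉ 0# → d ≉ 0# → (a / b) * (c / d) ≈ (a * c) / (b * d)
  /-*-/ {a} {b} {c} {d} b≉0 d≉0 = begin
    (a * b ⁻¹) * (c * d ⁻¹)   ≈⟨ solve 4 (λ a b c d → (a :* b) :* (c :* d) := (a :* c) :* (b :* d)) refl _ _ _ _ ⟩
    (a * c) * (b ⁻¹ * d ⁻¹)   ≈⟨ *-congˡ (⁻¹-*-distrib b≉0 d≉0) ⟨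
    (a * c) * (b * d) ⁻¹      ∎

  *-/-*-cancelʳ : ∀ {x d t} → d ≉ 0# → t ≉ 0# → (x * t) / (d * t) ≈ x / d
  *-/-*-cancelʳ {x} {d} {t} d≉0 t≉0 = begin
    x * t * (d * t) ⁻¹       ≈⟨ *-congˡ (⁻¹-*-distrib d≉0 t≉0) ⟩
    x * t * (d ⁻¹ * t ⁻¹)    ≈⟨ solve 4 (λ x t i j → x :* t :* (i :* j) := x :* i :* (t :* j)) refl x t _ _ ⟩
    x / d * (t * t ⁻¹)       ≈⟨ *-congˡ (inverseʳ t t≉0) ⟩
    x / d * 1#               ≈⟨ *-identityʳ _ ⟩
    x / d                    ∎

  ≈-/-+-/ : ∀ {x y dy t z dz w d} → d ≉ 0# → dy * t ≈ d → dz * w ≈ d →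
            x * d ≈ y * t + z * w → x ≈ y / dy + z / dz
  ≈-/-+-/ {x} {y} {dy} {t} {z} {dz} {w} {d} d≉0 dy*t≈d dz*w≈d eq = begin
    x                        ≈⟨ *-/-cancel x d≉0 ⟨
    x * d / d                ≈⟨ *-congʳ eq ⟩
    (y * t + z * w) / d      ≈⟨ distribʳ _ _ _ ⟩
    y * t / d + z * w / d    ≈⟨ +-cong (over dy*t≈d) (over dz*w≈d) ⟩
    y / dy + z / dz          ∎
    where
    over : ∀ {v dv s} → dv * s ≈ d → v * s / d ≈ v / dv
    over dv*s≈d = trans (*-congˡ (⁻¹-cong (sym dv*s≈d)))
      (*-/-*-cancelʳ (*-≉0ˡ (≉0-resp-≈ (sym dv*s≈d) d≉0)) (*-≉0ʳ (≉0-resp-≈ (sym dv*s≈d) d≉0)))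

  /-≈-/-+-/ : ∀ {x dx s y dy t z dz w d} → d ≉ 0# → dx * s ≈ d → dy * t ≈ d → dz * w ≈ d →
              x * s ≈ y * t + z * w → x / dx ≈ y / dy + z / dz
  /-≈-/-+-/ {x} {dx} {s} {d = d} d≉0 dx*s≈d dy*t≈d dz*w≈d eq = ≈-/-+-/ d≉0 dy*t≈d dz*w≈d (begin
    x / dx * d          ≈⟨ *-congˡ dx*s≈d ⟨
    x / dx * (dx * s)   ≈⟨ solve 4 (λ x i d s → x :* i :* (d :* s) := x :* d :* i :* s) refl x _ dx s ⟩
    x * dx / dx * s     ≈⟨ *-congʳ (*-/-cancel x (*-≉0ˡ (≉0-resp-≈ (sym dx*s≈d) d≉0))) ⟩
    x * s               ≈⟨ eq ⟩
    _                   ∎)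

  /-≈-/ : ∀ {x dx s y dy t d} → d ≉ 0# → dx * s ≈ d → dy * t ≈ d → x * s ≈ y * t → x / dx ≈ y / dy
  /-≈-/ {x} {dx} {s} {y} {dy} {t} {d} d≉0 dx*s≈d dy*t≈d eq = begin
    x / dx            ≈⟨ /-≈-/-+-/ d≉0 dx*s≈d dy*t≈d (*-identityˡ d) eq′ ⟩
    y / dy + 0# / 1#  ≈⟨ +-congˡ (zeroˡ _) ⟩
    y / dy + 0#       ≈⟨ +-identityʳ _ ⟩
    y / dy            ∎
    where
    eq′ : x * s ≈ y * t + 0# * d
    eq′ = trans eq (sym (trans (+-congˡ (zeroˡ d)) (+-identityʳ _)))

  ^-distribˡ-+-* : ∀ x m n → x ^ (m ℕ.+ n) ≈ x ^ m * x ^ n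
  ^-distribˡ-+-* x zero    n = sym (*-identityˡ _)
  ^-distribˡ-+-* x (suc m) n = trans (*-congˡ (^-distribˡ-+-* x m n)) (sym (*-assoc _ _ _))

  ^-distrib-* : ∀ x y m → (x * y) ^ m ≈ x ^ m * y ^ m
  ^-distrib-* x y zero    = sym (*-identityˡ _)
  ^-distrib-* x y (suc m) = trans (*-congˡ (^-distrib-* x y m))
    (solve 4 (λ x y X Y → (x :* y) :* (X :* Y) := (x :* X) :* (y :* Y)) refl _ _ _ _)

  ^-congˡ : ∀ {x y} m → x ≈ y → x ^ m ≈ y ^ m
  ^-congˡ zero    x≈y = refl
  ^-congˡ (suc m) x≈y = *-cong x≈y (^-congˡ m x≈y)

  sumTo-cong : ∀ n {f g : ℕ → Carrier} → (∀ k → k ≤ n → f k ≈ g k) → sumTo n f ≈ sumTo n g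
  sumTo-cong zero    f≈g = f≈g 0 z≤n
  sumTo-cong (suc n) f≈g = +-cong (sumTo-cong n (λ k k≤n → f≈g k (ℕ.m≤n⇒m≤1+n k≤n))) (f≈g (suc n) ℕ.≤-refl)

  sumTo-distrib-+ : ∀ n (f g : ℕ → Carrier) → sumTo n (λ k → f k + g k) ≈ sumTo n f + sumTo n g
  sumTo-distrib-+ zero    f g = refl
  sumTo-distrib-+ (suc n) f g = trans (+-congʳ (sumTo-distrib-+ n f g))
    (solve 4 (λ a b c d → a :+ b :+ (c :+ d) := a :+ c :+ (b :+ d)) refl _ _ _ _)

  *-distribˡ-sumTo : ∀ n x (f : ℕ → Carrier) → x * sumTo n f ≈ sumTo n (λ k → x * f k)
  *-distribˡ-sumTo zero    x f = refl
  *-distribˡ-sumTo (suc n) x f = trans (distribˡ x _ _) (+-congʳ (*-distribˡ-sumTo n x f))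

  *-distribʳ-sumTo : ∀ n x (f : ℕ → Carrier) → sumTo n f * x ≈ sumTo n (λ k → f k * x)
  *-distribʳ-sumTo zero    x f = refl
  *-distribʳ-sumTo (suc n) x f = trans (distribʳ x _ _) (+-congʳ (*-distribʳ-sumTo n x f))

  sumTo-pascal : ∀ n (s t u : ℕ → Carrier) →
                 s 0 ≈ t 0 → (∀ k → k ℕ.< n → s (suc k) ≈ t (suc k) + u k) → s (suc n) ≈ u n →
                 sumTo (suc n) s ≈ sumTo n t + sumTo n u
  sumTo-pascal n s t u s₀ sₖ sₙ = begin
    sumTo n s + s (suc n)                   ≈⟨ +-cong (sumTo-cong n s≈t+u′) sₙ ⟩
    sumTo n (λ k → t k + u′ k) + u n        ≈⟨ shift n ⟨
    sumTo n t + sumTo n u                   ∎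
    where
    u′ : ℕ → Carrier
    u′ zero    = 0#
    u′ (suc k) = u k

    s≈t+u′ : ∀ k → k ≤ n → s k ≈ t k + u′ k
    s≈t+u′ zero    _   = trans s₀ (sym (+-identityʳ _))
    s≈t+u′ (suc k) k<n = sₖ k k<n

    shift : ∀ n → sumTo n t + sumTo n u ≈ sumTo n (λ k → t k + u′ k) + u n
    shift zero    = +-congʳ (sym (+-identityʳ _))
    shift (suc n) = begin
      (sumTo n t + t (suc n)) + (sumTo n u + u (suc n))
        ≈⟨ solve 4 (λ a b c d → (a :+ b) :+ (c :+ d) := (a :+ c) :+ b :+ d) refl _ _ _ _ ⟩
      (sumTo n t + sumTo n u) + t (suc n) + u (suc n)
        ≈⟨ +-congʳ (+-congʳ (shift n)) ⟩
      (sumTo n (λ k → t k + u′ k) + u n) + t (suc n) + u (suc n)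
        ≈⟨ +-congʳ (solve 3 (λ a b c → a :+ b :+ c := a :+ (c :+ b)) refl _ _ _) ⟩
      sumTo n (λ k → t k + u′ k) + (t (suc n) + u n) + u (suc n) ∎

module CauchyPolynomials {ℓ₁ ℓ₂ : Level} (F : Field ℓ₁ ℓ₂) (q : Field.Carrier F) where
  open Field F
  open FieldOps F
  open FieldProperties F
  open IntegerCoefficients commutativeRing
  open import Relation.Binary.Reasoning.Setoid setoid

  poch-cong : ∀ {x y} m → x ≈ y → poch q x m ≈ poch q y m
  poch-cong zero    x≈y = refl
  poch-cong (suc m) x≈y = *-cong (poch-cong m x≈y) (+-congˡ (-‿cong (*-congʳ x≈y)))

  poch-suc-head : ∀ x m → poch q x (suc m) ≈ (1# - x) * poch q (x * q) m
  poch-suc-head x zero    = solve 1 (λ x → con (+ 1) :* (con (+ 1) :- x :* con (+ 1)) := (con (+ 1) :- x) :* con (+ 1)) refl x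
  poch-suc-head x (suc m) = begin
    poch q x (suc m) * (1# - x * q ^ suc m)
      ≈⟨ *-congʳ (poch-suc-head x m) ⟩
    (1# - x) * poch q (x * q) m * (1# - x * (q * q ^ m))
      ≈⟨ solve 5 (λ x p q Q r → (con (+ 1) :- x) :* p :* (con (+ 1) :- x :* (q :* Q)) := (con (+ 1) :- x) :* (p :* (con (+ 1) :- x :* q :* Q))) refl x _ q (q ^ m) x ⟩
    (1# - x) * (poch q (x * q) m * (1# - x * q * q ^ m)) ∎

  P-cong : ∀ m {x x′ z z′} → x ≈ x′ → z ≈ z′ → P q m x z ≈ P q m x′ z′
  P-cong m x≈x′ z≈z′ = *-cong (^-congˡ m x≈x′) (poch-cong m (*-cong z≈z′ (⁻¹-cong x≈x′)))

  P-suc : ∀ m {x} z → x ≉ 0# → P q (suc m) x z ≈ P q m x z * (x - z * q ^ m)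
  P-suc m {x} z x≉0 = begin
    x * x ^ m * (poch q (z / x) m * (1# - z / x * q ^ m))
      ≈⟨ solve 5 (λ x X p Q w → x :* X :* (p :* (con (+ 1) :- w :* Q)) := X :* p :* (x :- w :* x :* Q)) refl x (x ^ m) _ (q ^ m) (z / x) ⟩
    x ^ m * poch q (z / x) m * (x - z / x * x * q ^ m)
      ≈⟨ *-congˡ (+-congˡ (-‿cong (*-congʳ (/-*-cancel z x≉0)))) ⟩
    x ^ m * poch q (z / x) m * (x - z * q ^ m) ∎

  P-suc-head : ∀ m {x} z → x ≉ 0# → P q (suc m) x z ≈ (x - z) * P q m x (z * q)
  P-suc-head m {x} z x≉0 = begin
    x * x ^ m * poch q (z / x) (suc m)
      ≈⟨ *-congˡ (poch-suc-head (z / x) m) ⟩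
    x * x ^ m * ((1# - z / x) * poch q (z / x * q) m)
      ≈⟨ solve 4 (λ x X w p → x :* X :* ((con (+ 1) :- w) :* p) := (x :- w :* x) :* (X :* p)) refl x (x ^ m) (z / x) _ ⟩
    (x - z / x * x) * (x ^ m * poch q (z / x * q) m)
      ≈⟨ *-cong (+-congˡ (-‿cong (/-*-cancel z x≉0)))
                (*-congˡ (poch-cong m (solve 3 (λ z i q → z :* i :* q := z :* q :* i) refl z (x ⁻¹) q))) ⟩
    (x - z) * (x ^ m * poch q (z * q / x) m) ∎

  P-homogeneous : ∀ m {l x} z → l ≉ 0# → x ≉ 0# → P q m (l * x) (l * z) ≈ l ^ m * P q m x z
  P-homogeneous m {l} {x} z l≉0 x≉0 = begin
    (l * x) ^ m * poch q (l * z / (l * x)) m  ≈⟨ *-cong (^-distrib-* l x m) (poch-cong m cancel-l) ⟩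
    l ^ m * x ^ m * poch q (z / x) m          ≈⟨ *-assoc _ _ _ ⟩
    l ^ m * (x ^ m * poch q (z / x) m)        ∎
    where
    cancel-l : l * z / (l * x) ≈ z / x
    cancel-l = begin
      l * z * (l * x) ⁻¹       ≈⟨ *-congˡ (⁻¹-*-distrib l≉0 x≉0) ⟩
      l * z * (l ⁻¹ * x ⁻¹)    ≈⟨ solve 4 (λ l z i j → l :* z :* (i :* j) := l :* i :* (z :* j)) refl l z _ _ ⟩
      l / l * (z / x)          ≈⟨ *-congʳ (inverseʳ l l≉0) ⟩
      1# * (z / x)             ≈⟨ *-identityˡ _ ⟩
      z / x                    ∎

module Expansion {ℓ₁ ℓ₂ : Level} (F : Field ℓ₁ ℓ₂) (u y a c q : Field.Carrier F) where
  open Field F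
  open FieldOps F
  open FieldProperties F
  open CauchyPolynomials F q
  open IntegerCoefficients commutativeRing
  open import Relation.Binary.Reasoning.Setoid setoid

  -- In coordinates m = n ∸ k, k, term m k b is the k-th summand of the statement. The truncated
  -- exponents m ∸ 1 and m + k ∸ 1 below are only used in factors of positive length, where they are exact.
  num₁ : ℕ → ℕ → Carrier → Carrier
  num₁ m k b = P q m b (u * q ^ (m ℕ.+ k ∸ 1))

  num₂ : ℕ → ℕ → Carrier
  num₂ m k = P q k a (u * q ^ m)

  num₃ : ℕ → Carrier → Carrier
  num₃ m b = P q m u (c / b)

  num₄ : ℕ → Carrier
  num₄ k = P q k (c / a) u

  num : ℕ → ℕ → Carrier → Carrier
  num m k b = num₁ m k b * num₂ m k * num₃ m b * num₄ k

  den₁ : ℕ → Carrier → Carrier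
  den₁ n b = P q n b a

  den₂ : ℕ → Carrier → Carrier
  den₂ m b = poch q (c * q ^ (m ∸ 1) / (a * b)) m

  den₃ : ℕ → ℕ → Carrier → Carrier
  den₃ m k b = poch q (c * q ^ (2 ℕ.* m) / (a * b)) k

  den : ℕ → ℕ → Carrier → Carrier
  den m k b = den₁ (m ℕ.+ k) b * den₂ m b * den₃ m k b

  coeff : ℕ → ℕ → Carrier → Carrier
  coeff m k b = qbinom q (m ℕ.+ k) k * (num m k b / den m k b)

  Ya : ℕ → Carrier
  Ya m = P q m y (a * (q ^ (m ∸ 1)) ⁻¹)

  Yc/a : ℕ → Carrier
  Yc/a m = P q m y (c / a)

  Yb : ℕ → ℕ → Carrier → Carrier
  Yb m k b = P q k y (b * (q ^ (m ℕ.+ k ∸ 1)) ⁻¹)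

  Yc/b : ℕ → ℕ → Carrier → Carrier
  Yc/b m k b = P q k y (c * q ^ m / b)

  basis : ℕ → ℕ → Carrier → Carrier
  basis m k b = Ya m * Yc/a m * Yb m k b * Yc/b m k b

  term : ℕ → ℕ → Carrier → Carrier
  term m k b = coeff m k b * Ya m * Yc/a m * Yb m k b * Yc/b m k b

  term≈coeff*basis : ∀ m k b → term m k b ≈ coeff m k b * basis m k b
  term≈coeff*basis m k b = solve 5 (λ K y₁ y₂ y₃ y₄ → K :* y₁ :* y₂ :* y₃ :* y₄ := K :* (y₁ :* y₂ :* y₃ :* y₄)) refl _ _ _ _ _

  factor : ℕ → Carrier
  factor n = (u * q ^ n - y) * (c - u * q ^ n * y)

  lhs : ℕ → Carrier
  lhs n = prod1To n (λ i → factor (i ∸ 1))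

  rhs : ℕ → Carrier → Carrier
  rhs n b = q ^ (n C 2) * sumTo n (λ k → term (n ∸ k) k b)

  record Nondegenerate (n : ℕ) (b : Carrier) : Set ℓ₂ where
    field
      qfac≉0 : ∀ j → j ≤ n → poch q q j ≉ 0#
      den₁≉0 : den₁ n b ≉ 0#
      den₂≉0 : ∀ m k → m ℕ.+ k ≡ n → den₂ m b ≉ 0#
      den₃≉0 : ∀ m k → m ℕ.+ k ≡ n → den₃ m k b ≉ 0#

  den≉0 : ∀ {n b} → Nondegenerate n b → ∀ m k → m ℕ.+ k ≡ n → den m k b ≉ 0#
  den≉0 nd m k ≡.refl = *-≉0 (*-≉0 den₁≉0 (den₂≉0 m k ≡.refl)) (den₃≉0 m k ≡.refl)
    where open Nondegenerate nd

  qnum : ℕ → ℕ → Carrier → Carrier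
  qnum m k b = poch q q (m ℕ.+ k) * num m k b

  qden : ℕ → ℕ → Carrier → Carrier
  qden m k b = poch q q k * poch q q m * den m k b

  coeff≈qnum/qden : ∀ m k b → poch q q k ≉ 0# → poch q q m ≉ 0# → den m k b ≉ 0# → coeff m k b ≈ qnum m k b / qden m k b
  coeff≈qnum/qden m k b k≉0 m≉0 den≉0 = begin
    poch q q (m ℕ.+ k) / (poch q q k * poch q q (m ℕ.+ k ∸ k)) * (num m k b / den m k b)
      ≡⟨ ≡.cong (λ j → poch q q (m ℕ.+ k) / (poch q q k * poch q q j) * (num m k b / den m k b)) (ℕ.m+n∸n≡m m k) ⟩
    poch q q (m ℕ.+ k) / (poch q q k * poch q q m) * (num m k b / den m k b)
      ≈⟨ /-*-/ (*-≉0 k≉0 m≉0) den≉0 ⟩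
    qnum m k b / qden m k b ∎

  num₁-index : ∀ m k x → num₁ m (suc k) x ≈ P q m x (u * q ^ (m ℕ.+ k))
  num₁-index m k x = reflexive (≡.cong (λ j → P q m x (u * q ^ (j ∸ 1))) (ℕ.+-suc m k))

  module _ (u≉0 : u ≉ 0#) (y≉0 : y ≉ 0#) (a≉0 : a ≉ 0#) (c≉0 : c ≉ 0#) (q≉0 : q ≉ 0#) where

    Ya-suc : ∀ m → Ya (suc m) ≈ (y - a * (q ^ m) ⁻¹) * Ya m
    Ya-suc zero    = P-suc-head 0 (a * (q ^ 0) ⁻¹) y≉0
    Ya-suc (suc m) = trans (P-suc-head (suc m) (a * (q ^ suc m) ⁻¹) y≉0) (*-congˡ (P-cong (suc m) refl shift))
      where
      shift : a * (q * q ^ m) ⁻¹ * q ≈ a * (q ^ m) ⁻¹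
      shift = begin
        a * (q * q ^ m) ⁻¹ * q        ≈⟨ *-congʳ (*-congˡ (⁻¹-*-distrib q≉0 (^-≉0 m q≉0))) ⟩
        a * (q ⁻¹ * (q ^ m) ⁻¹) * q   ≈⟨ solve 4 (λ a i r q → a :* (i :* r) :* q := a :* r :* (q :* i)) refl a _ _ q ⟩
        a * (q ^ m) ⁻¹ * (q * q ⁻¹)   ≈⟨ *-congˡ (inverseʳ q q≉0) ⟩
        a * (q ^ m) ⁻¹ * 1#           ≈⟨ *-identityʳ _ ⟩
        a * (q ^ m) ⁻¹                ∎

    Yc/a-suc : ∀ m → Yc/a (suc m) ≈ Yc/a m * (y - c / a * q ^ m)
    Yc/a-suc m = P-suc m (c / a) y≉0

    num₂-sucᵏ : ∀ m k → num₂ (suc m) (suc k) ≈ num₂ (suc m) k * (a - u * (q * q ^ m) * q ^ k)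
    num₂-sucᵏ m k = P-suc k _ a≉0

    num₂-sucᵏ-head : ∀ m k → num₂ m (suc k) ≈ (a - u * q ^ m) * num₂ (suc m) k
    num₂-sucᵏ-head m k = trans (P-suc-head k _ a≉0)
      (*-congˡ (P-cong k refl (solve 3 (λ u Q q → u :* Q :* q := u :* (q :* Q)) refl u _ q)))

    module Shift (b : Carrier) (b≉0 : b ≉ 0#) where

      b′ : Carrier
      b′ = b / q

      γ : Carrier
      γ = c / (a * b)

      b′≉0 : b′ ≉ 0#
      b′≉0 = *-≉0 b≉0 (⁻¹-≉0 q≉0)

      b≈b′q : b ≈ b′ * q
      b≈b′q = sym (/-*-cancel b q≉0)

      b≈qb′ : b ≈ q * b′
      b≈qb′ = trans b≈b′q (*-comm b′ q)

      c≈γab : c ≈ γ * a * b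
      c≈γab = sym (trans (*-assoc γ a b) (/-*-cancel c (*-≉0 a≉0 b≉0)))

      c/a≈γb′q : c / a ≈ γ * (b′ * q)
      c/a≈γb′q = begin
        c / a                ≈⟨ *-congʳ c≈γab ⟩
        γ * a * b / a        ≈⟨ solve 4 (λ g a b i → g :* a :* b :* i := g :* b :* (a :* i)) refl γ a b _ ⟩
        γ * b * (a / a)      ≈⟨ *-congˡ (inverseʳ a a≉0) ⟩
        γ * b * 1#           ≈⟨ *-identityʳ _ ⟩
        γ * b                ≈⟨ *-congˡ b≈b′q ⟩
        γ * (b′ * q)         ∎

      c/b≈γa : c / b ≈ γ * a
      c/b≈γa = trans (*-congʳ c≈γab) (*-/-cancel (γ * a) b≉0)

      /b*q≈/b′ : ∀ x → x / b * q ≈ x / b′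
      /b*q≈/b′ x = *⇒/ b′≉0 (begin
        x / b * q * b′      ≈⟨ solve 4 (λ x i q b → x :* i :* q :* b := x :* (b :* q :* i)) refl x _ q b′ ⟩
        x * (b′ * q / b)    ≈⟨ *-congˡ (*-congʳ (sym b≈b′q)) ⟩
        x * (b / b)         ≈⟨ *-congˡ (inverseʳ b b≉0) ⟩
        x * 1#              ≈⟨ *-identityʳ x ⟩
        x                   ∎)

      c/b′≈γaq : c / b′ ≈ γ * a * q
      c/b′≈γaq = trans (sym (/b*q≈/b′ c)) (*-congʳ c/b≈γa)

      cx/ab≈γx : ∀ x → c * x / (a * b) ≈ γ * x
      cx/ab≈γx x = solve 3 (λ c x i → c :* x :* i := c :* i :* x) refl c x _

      cx/ab′≈γqx : ∀ x → c * x / (a * b′) ≈ γ * (q * x)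
      cx/ab′≈γqx x = sym (*⇒/ (*-≉0 a≉0 b′≉0) (begin
        γ * (q * x) * (a * b′)      ≈⟨ solve 6 (λ c i q x a b → c :* i :* (q :* x) :* (a :* b) := c :* x :* (i :* (a :* (b :* q)))) refl c _ q x a b′ ⟩
        c * x * ((a * b) ⁻¹ * (a * (b′ * q))) ≈⟨ *-congˡ (*-congˡ (*-congˡ (sym b≈b′q))) ⟩
        c * x * ((a * b) ⁻¹ * (a * b)) ≈⟨ *-congˡ (inverseˡ (a * b) (*-≉0 a≉0 b≉0)) ⟩
        c * x * 1#                  ≈⟨ *-identityʳ _ ⟩
        c * x                       ∎))

      b/q^[1+j]≈b′/q^j : ∀ j → b * (q ^ suc j) ⁻¹ ≈ b′ * (q ^ j) ⁻¹
      b/q^[1+j]≈b′/q^j j = begin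
        b * (q * q ^ j) ⁻¹           ≈⟨ *-cong b≈b′q (⁻¹-*-distrib q≉0 (^-≉0 j q≉0)) ⟩
        b′ * q * (q ⁻¹ * (q ^ j) ⁻¹) ≈⟨ solve 4 (λ b q i r → b :* q :* (i :* r) := b :* r :* (q :* i)) refl b′ q _ _ ⟩
        b′ * (q ^ j) ⁻¹ * (q / q)    ≈⟨ *-congˡ (inverseʳ q q≉0) ⟩
        b′ * (q ^ j) ⁻¹ * 1#         ≈⟨ *-identityʳ _ ⟩
        b′ * (q ^ j) ⁻¹              ∎

      Yb-sucᵐ : ∀ m k → Yb (suc m) k b ≈ Yb m k b′
      Yb-sucᵐ m zero    = refl
      Yb-sucᵐ m (suc k) rewrite ℕ.+-suc m k = P-cong (suc k) refl (b/q^[1+j]≈b′/q^j (m ℕ.+ k))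

      Yc/b-sucᵐ : ∀ m k → Yc/b (suc m) k b ≈ Yc/b m k b′
      Yc/b-sucᵐ m k = P-cong k refl (begin
        c * (q * q ^ m) / b     ≈⟨ solve 4 (λ c q Q i → c :* (q :* Q) :* i := c :* Q :* i :* q) refl c q _ _ ⟩
        c * q ^ m / b * q       ≈⟨ /b*q≈/b′ _ ⟩
        c * q ^ m / b′          ∎)

      Yb-sucᵏ : ∀ m k → Yb m (suc k) b ≈ Yb m k b′ * (y - b * (q ^ m) ⁻¹)
      Yb-sucᵏ m k rewrite ℕ.+-suc m k = begin
        P q (suc k) y (b * (q ^ (m ℕ.+ k)) ⁻¹)
          ≈⟨ P-suc k _ y≉0 ⟩
        P q k y (b * (q ^ (m ℕ.+ k)) ⁻¹) * (y - b * (q ^ (m ℕ.+ k)) ⁻¹ * q ^ k)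
          ≈⟨ *-cong (Yb-sucᵐ m k) (+-congˡ (-‿cong b/q^[m+k]*q^k)) ⟩
        Yb m k b′ * (y - b * (q ^ m) ⁻¹) ∎
        where
        b/q^[m+k]*q^k : b * (q ^ (m ℕ.+ k)) ⁻¹ * q ^ k ≈ b * (q ^ m) ⁻¹
        b/q^[m+k]*q^k = begin
          b * (q ^ (m ℕ.+ k)) ⁻¹ * q ^ k
            ≈⟨ *-congʳ (*-congˡ (trans (⁻¹-cong (^-distribˡ-+-* q m k)) (⁻¹-*-distrib (^-≉0 m q≉0) (^-≉0 k q≉0)))) ⟩
          b * ((q ^ m) ⁻¹ * (q ^ k) ⁻¹) * q ^ k
            ≈⟨ solve 4 (λ b i j K → b :* (i :* j) :* K := b :* i :* (j :* K)) refl b _ _ _ ⟩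
          b * (q ^ m) ⁻¹ * ((q ^ k) ⁻¹ * q ^ k)
            ≈⟨ *-congˡ (inverseˡ (q ^ k) (^-≉0 k q≉0)) ⟩
          b * (q ^ m) ⁻¹ * 1#
            ≈⟨ *-identityʳ _ ⟩
          b * (q ^ m) ⁻¹ ∎

      Yc/b-sucᵏ : ∀ m k → Yc/b m (suc k) b ≈ (y - c * q ^ m / b) * Yc/b m k b′
      Yc/b-sucᵏ m k = trans (P-suc-head k (c * q ^ m / b) y≉0) (*-congˡ (P-cong k refl (/b*q≈/b′ _)))

      ΔA : ℕ → Carrier
      ΔA m = (y - a * (q ^ m) ⁻¹) * (y - c / a * q ^ m)

      ΔB : ℕ → Carrier
      ΔB m = (y - b * (q ^ m) ⁻¹) * (y - c * q ^ m / b)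

      basis-sucᵐ : ∀ m k → basis (suc m) k b ≈ basis m k b′ * ΔA m
      basis-sucᵐ m k = begin
        Ya (suc m) * Yc/a (suc m) * Yb (suc m) k b * Yc/b (suc m) k b
          ≈⟨ *-cong (*-cong (*-cong (Ya-suc m) (Yc/a-suc m)) (Yb-sucᵐ m k)) (Yc/b-sucᵐ m k) ⟩
        (y - a * (q ^ m) ⁻¹) * Ya m * (Yc/a m * (y - c / a * q ^ m)) * Yb m k b′ * Yc/b m k b′
          ≈⟨ solve 6 (λ e₁ y₁ y₂ e₂ y₃ y₄ → e₁ :* y₁ :* (y₂ :* e₂) :* y₃ :* y₄ := y₁ :* y₂ :* y₃ :* y₄ :* (e₁ :* e₂)) refl _ _ _ _ _ _ ⟩
        basis m k b′ * ΔA m ∎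

      basis-sucᵏ : ∀ m k → basis m (suc k) b ≈ basis m k b′ * ΔB m
      basis-sucᵏ m k = begin
        Ya m * Yc/a m * Yb m (suc k) b * Yc/b m (suc k) b
          ≈⟨ *-cong (*-congˡ (Yb-sucᵏ m k)) (Yc/b-sucᵏ m k) ⟩
        Ya m * Yc/a m * (Yb m k b′ * (y - b * (q ^ m) ⁻¹)) * ((y - c * q ^ m / b) * Yc/b m k b′)
          ≈⟨ solve 6 (λ y₁ y₂ y₃ e₁ e₂ y₄ → y₁ :* y₂ :* (y₃ :* e₁) :* (e₂ :* y₄) := y₁ :* y₂ :* y₃ :* y₄ :* (e₁ :* e₂)) refl _ _ _ _ _ _ ⟩
        basis m k b′ * ΔB m ∎

      wA-num : ℕ → ℕ → Carrier
      wA-num m k = q ^ m * (u * (q ^ m * q ^ k) * q ^ m - b′ * q) * (u * q ^ k - γ * a)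

      wA-den : ℕ → Carrier
      wA-den m = (a - b′ * q) * (1# - γ * (q ^ m * q ^ m))

      wB-num : ℕ → ℕ → Carrier
      wB-num m k = q ^ m * (u * (q ^ m * q ^ k) * q ^ m - a) * (u * q ^ k - γ * (b′ * q))

      wB-den : ℕ → Carrier
      wB-den m = (b′ * q - a) * (1# - γ * (q ^ m * q ^ m))

      wA : ℕ → ℕ → Carrier
      wA m k = wA-num m k / wA-den m

      wB : ℕ → ℕ → Carrier
      wB m k = wB-num m k / wB-den m

      factor-split : ∀ m k → wA-den m ≉ 0# → wB-den m ≉ 0# → factor (m ℕ.+ k) ≈ wA m k * ΔA m + wB m k * ΔB m
      factor-split m k A≉0 B≉0 = begin
        factor (m ℕ.+ k)
          ≈⟨ ≈-/-+-/ (*-≉0 (*-≉0 A≉0 B≉0) (^-≉0 m q≉0)) (sym (*-assoc _ _ _))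
                (solve 3 (λ A B Q → B :* (A :* Q) := A :* B :* Q) refl (wA-den m) (wB-den m) Q) cleared ⟩
        wA-num m k * ΔA m / wA-den m + wB-num m k * ΔB m / wB-den m
          ≈⟨ +-cong (solve 3 (λ n Δ i → n :* Δ :* i := n :* i :* Δ) refl _ _ _) (solve 3 (λ n Δ i → n :* Δ :* i := n :* i :* Δ) refl _ _ _) ⟩
        wA m k * ΔA m + wB m k * ΔB m ∎
        where
        Q K : Carrier
        Q = q ^ m
        K = q ^ k

        factor≈ : factor (m ℕ.+ k) ≈ (u * (Q * K) - y) * (γ * a * (b′ * q) - u * (Q * K) * y)
        factor≈ = *-cong (+-congʳ (*-congˡ (^-distribˡ-+-* q m k)))
                         (+-cong (trans c≈γab (*-congˡ b≈b′q)) (-‿cong (*-congʳ (*-congˡ (^-distribˡ-+-* q m k)))))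

        ΔA*Q : ΔA m * Q ≈ (y * Q - a) * (y - γ * (b′ * q) * Q)
        ΔA*Q = begin
          (y - a * Q ⁻¹) * (y - c / a * Q) * Q
            ≈⟨ solve 4 (λ y aR r Q → (y :- aR) :* (y :- r :* Q) :* Q := (y :* Q :- aR :* Q) :* (y :- r :* Q)) refl y (a * Q ⁻¹) (c / a) Q ⟩
          (y * Q - a * Q ⁻¹ * Q) * (y - c / a * Q)
            ≈⟨ *-cong (+-congˡ (-‿cong (/-*-cancel a (^-≉0 m q≉0)))) (+-congˡ (-‿cong (*-congʳ c/a≈γb′q))) ⟩
          (y * Q - a) * (y - γ * (b′ * q) * Q) ∎

        ΔB*Q : ΔB m * Q ≈ (y * Q - b′ * q) * (y - γ * a * Q)
        ΔB*Q = begin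
          (y - b * Q ⁻¹) * (y - c * Q / b) * Q
            ≈⟨ solve 4 (λ y bR r Q → (y :- bR) :* (y :- r) :* Q := (y :* Q :- bR :* Q) :* (y :- r)) refl y (b * Q ⁻¹) (c * Q / b) Q ⟩
          (y * Q - b * Q ⁻¹ * Q) * (y - c * Q / b)
            ≈⟨ *-cong (+-congˡ (-‿cong (trans (/-*-cancel b (^-≉0 m q≉0)) b≈b′q)))
                      (+-congˡ (-‿cong (trans (solve 3 (λ c Q i → c :* Q :* i := c :* i :* Q) refl c Q _) (*-congʳ c/b≈γa)))) ⟩
          (y * Q - b′ * q) * (y - γ * a * Q) ∎

        cleared : factor (m ℕ.+ k) * (wA-den m * wB-den m * Q) ≈ wA-num m k * ΔA m * (wB-den m * Q) + wB-num m k * ΔB m * (wA-den m * Q)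
        cleared = begin
          factor (m ℕ.+ k) * (wA-den m * wB-den m * Q)
            ≈⟨ *-congʳ factor≈ ⟩
          (u * (Q * K) - y) * (γ * a * (b′ * q) - u * (Q * K) * y) * (wA-den m * wB-den m * Q)
            ≈⟨ solve 8 (λ q Q K u y a b g →
                 (u :* (Q :* K) :- y) :* (g :* a :* (b :* q) :- u :* (Q :* K) :* y)
                   :* ((a :- b :* q) :* (con (+ 1) :- g :* (Q :* Q)) :* ((b :* q :- a) :* (con (+ 1) :- g :* (Q :* Q))) :* Q)
                 := Q :* (u :* (Q :* K) :* Q :- b :* q) :* (u :* K :- g :* a) :* ((y :* Q :- a) :* (y :- g :* (b :* q) :* Q))
                      :* ((b :* q :- a) :* (con (+ 1) :- g :* (Q :* Q)))
                    :+ Q :* (u :* (Q :* K) :* Q :- a) :* (u :* K :- g :* (b :* q)) :* ((y :* Q :- b :* q) :* (y :- g :* a :* Q))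
                      :* ((a :- b :* q) :* (con (+ 1) :- g :* (Q :* Q))))
                 refl q Q K u y a b′ γ ⟩
          wA-num m k * ((y * Q - a) * (y - γ * (b′ * q) * Q)) * wB-den m + wB-num m k * ((y * Q - b′ * q) * (y - γ * a * Q)) * wA-den m
            ≈⟨ +-cong (*-congʳ (*-congˡ ΔA*Q)) (*-congʳ (*-congˡ ΔB*Q)) ⟨
          wA-num m k * (ΔA m * Q) * wB-den m + wB-num m k * (ΔB m * Q) * wA-den m
            ≈⟨ +-cong (solve 4 (λ n Δ Q d → n :* (Δ :* Q) :* d := n :* Δ :* (d :* Q)) refl _ _ _ _)
                      (solve 4 (λ n Δ Q d → n :* (Δ :* Q) :* d := n :* Δ :* (d :* Q)) refl _ _ _ _) ⟩
          wA-num m k * ΔA m * (wB-den m * Q) + wB-num m k * ΔB m * (wA-den m * Q) ∎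

      basis-factor : ∀ m k → wA-den m ≉ 0# → wB-den m ≉ 0# →
                     basis m k b′ * factor (m ℕ.+ k) ≈ wA m k * basis (suc m) k b + wB m k * basis m (suc k) b
      basis-factor m k A≉0 B≉0 = begin
        basis m k b′ * factor (m ℕ.+ k)
          ≈⟨ *-congˡ (factor-split m k A≉0 B≉0) ⟩
        basis m k b′ * (wA m k * ΔA m + wB m k * ΔB m)
          ≈⟨ solve 5 (λ B α Δ β Δ′ → B :* (α :* Δ :+ β :* Δ′) := α :* (B :* Δ) :+ β :* (B :* Δ′)) refl _ _ _ _ _ ⟩
        wA m k * (basis m k b′ * ΔA m) + wB m k * (basis m k b′ * ΔB m)
          ≈⟨ +-cong (*-congˡ (basis-sucᵐ m k)) (*-congˡ (basis-sucᵏ m k)) ⟨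
        wA m k * basis (suc m) k b + wB m k * basis m (suc k) b ∎

      q^2m≈q^m*q^m : ∀ m → q ^ (2 ℕ.* m) ≈ q ^ m * q ^ m
      q^2m≈q^m*q^m m = begin
        q ^ (m ℕ.+ (m ℕ.+ 0))   ≈⟨ ^-distribˡ-+-* q m (m ℕ.+ 0) ⟩
        q ^ m * q ^ (m ℕ.+ 0)   ≡⟨ ≡.cong (λ j → q ^ m * q ^ j) (ℕ.+-identityʳ m) ⟩
        q ^ m * q ^ m           ∎

      num₁-sucᵐᵏ : ∀ m k → num₁ (suc m) (suc k) b ≈ P q m b′ (u * q ^ (m ℕ.+ k)) * (q * q ^ m * (b′ - u * (q ^ m * q ^ k) * q ^ m))
      num₁-sucᵐᵏ m k = begin
        P q (suc m) b (u * q ^ (m ℕ.+ suc k))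
          ≈⟨ P-cong (suc m) b≈qb′ (trans (*-congˡ (reflexive (≡.cong (q ^_) (ℕ.+-suc m k)))) (solve 3 (λ u q w → u :* (q :* w) := q :* (u :* w)) refl u q _)) ⟩
        P q (suc m) (q * b′) (q * (u * q ^ (m ℕ.+ k)))
          ≈⟨ P-homogeneous (suc m) _ q≉0 b′≉0 ⟩
        q ^ suc m * P q (suc m) b′ (u * q ^ (m ℕ.+ k))
          ≈⟨ *-congˡ (P-suc m _ b′≉0) ⟩
        q * q ^ m * (P q m b′ (u * q ^ (m ℕ.+ k)) * (b′ - u * q ^ (m ℕ.+ k) * q ^ m))
          ≈⟨ solve 3 (λ x p z → x :* (p :* z) := p :* (x :* z)) refl _ _ _ ⟩
        P q m b′ (u * q ^ (m ℕ.+ k)) * (q * q ^ m * (b′ - u * q ^ (m ℕ.+ k) * q ^ m))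
          ≈⟨ *-congˡ (*-congˡ (+-congˡ (-‿cong (*-congʳ (*-congˡ (^-distribˡ-+-* q m k)))))) ⟩
        P q m b′ (u * q ^ (m ℕ.+ k)) * (q * q ^ m * (b′ - u * (q ^ m * q ^ k) * q ^ m)) ∎

      num₁-sucᵐ : ∀ m k → num₁ (suc m) k b′ ≈ P q m b′ (u * q ^ (m ℕ.+ k)) * (b′ - u * (q ^ m * q ^ k) * q ^ m)
      num₁-sucᵐ m k = trans (P-suc m _ b′≉0) (*-congˡ (+-congˡ (-‿cong (*-congʳ (*-congˡ (^-distribˡ-+-* q m k))))))

      num₃-sucᵐ : ∀ m → num₃ (suc m) b ≈ (u - γ * a) * num₃ m b′
      num₃-sucᵐ m = trans (P-suc-head m _ u≉0) (*-cong (+-congˡ (-‿cong c/b≈γa)) (P-cong m refl (/b*q≈/b′ c)))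

      num₃-sucᵐ′ : ∀ m → num₃ (suc m) b′ ≈ num₃ m b′ * (u - γ * a * q * q ^ m)
      num₃-sucᵐ′ m = trans (P-suc m _ u≉0) (*-congˡ (+-congˡ (-‿cong (*-congʳ c/b′≈γaq))))

      num₄-sucᵏ : ∀ k → num₄ (suc k) ≈ num₄ k * (γ * (b′ * q) - u * q ^ k)
      num₄-sucᵏ k = trans (P-suc k u (*-≉0 c≉0 (⁻¹-≉0 a≉0))) (*-congˡ (+-congʳ c/a≈γb′q))

      den₁-suc : ∀ j → den₁ (suc j) b ≈ den₁ j b′ * ((b′ * q - a) * q ^ j)
      den₁-suc j = begin
        P q (suc j) b a                ≈⟨ P-suc-head j a b≉0 ⟩
        (b - a) * P q j b (a * q)      ≈⟨ *-congˡ (P-cong j b≈qb′ (*-comm a q)) ⟩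
        (b - a) * P q j (q * b′) (q * a) ≈⟨ *-congˡ (P-homogeneous j a q≉0 b′≉0) ⟩
        (b - a) * (q ^ j * P q j b′ a) ≈⟨ solve 3 (λ x Q p → x :* (Q :* p) := p :* (x :* Q)) refl _ _ _ ⟩
        P q j b′ a * ((b - a) * q ^ j) ≈⟨ *-congˡ (*-congʳ (+-congʳ b≈b′q)) ⟩
        P q j b′ a * ((b′ * q - a) * q ^ j) ∎

      den₂-sucᵐ : ∀ m → den₂ (suc m) b ≈ poch q (γ * q ^ m) m * (1# - γ * (q ^ m * q ^ m))
      den₂-sucᵐ m = trans (poch-cong (suc m) (cx/ab≈γx _)) (*-congˡ (+-congˡ (-‿cong (*-assoc _ _ _))))

      den₂-b′ : ∀ m → den₂ m b′ ≈ poch q (γ * q ^ m) m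
      den₂-b′ zero    = refl
      den₂-b′ (suc m) = poch-cong (suc m) (cx/ab′≈γqx _)

      den₂-sucᵐ′ : ∀ m → den₂ (suc m) b′ * (1# - γ * q ^ m) ≈ poch q (γ * q ^ m) m * ((1# - γ * (q ^ m * q ^ m)) * (1# - γ * (q ^ m * q ^ m) * q))
      den₂-sucᵐ′ m = begin
        poch q (c * q ^ m / (a * b′)) (suc m) * (1# - x)
          ≈⟨ *-congʳ (poch-cong (suc m) (trans (cx/ab′≈γqx _) (solve 3 (λ g q Q → g :* (q :* Q) := g :* Q :* q) refl γ q _))) ⟩
        poch q (x * q) m * (1# - x * q * q ^ m) * (1# - x)
          ≈⟨ solve 3 (λ p r s → p :* r :* s := s :* p :* r) refl _ _ _ ⟩
        (1# - x) * poch q (x * q) m * (1# - x * q * q ^ m)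
          ≈⟨ *-congʳ (poch-suc-head x m) ⟨
        poch q x m * (1# - x * q ^ m) * (1# - x * q * q ^ m)
          ≈⟨ solve 4 (λ p g Q q → p :* (con (+ 1) :- g :* Q :* Q) :* (con (+ 1) :- g :* Q :* q :* Q)
                                := p :* ((con (+ 1) :- g :* (Q :* Q)) :* (con (+ 1) :- g :* (Q :* Q) :* q))) refl _ γ _ q ⟩
        poch q x m * ((1# - γ * (q ^ m * q ^ m)) * (1# - γ * (q ^ m * q ^ m) * q)) ∎
        where
        x : Carrier
        x = γ * q ^ m

      den₃-sucᵐᵏ : ∀ m k → den₃ (suc m) (suc k) b ≈ poch q (γ * (q ^ m * q ^ m) * q * q) k * (1# - γ * (q ^ m * q ^ m) * q * q * q ^ k)
      den₃-sucᵐᵏ m k = poch-cong (suc k) (begin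
        c * q ^ (2 ℕ.* suc m) / (a * b)   ≈⟨ cx/ab≈γx _ ⟩
        γ * q ^ (2 ℕ.* suc m)             ≈⟨ *-congˡ (q^2m≈q^m*q^m (suc m)) ⟩
        γ * ((q * q ^ m) * (q * q ^ m))   ≈⟨ solve 3 (λ g q Q → g :* ((q :* Q) :* (q :* Q)) := g :* (Q :* Q) :* q :* q) refl γ q _ ⟩
        γ * (q ^ m * q ^ m) * q * q       ∎)

      den₃-sucᵏ′ : ∀ m k → den₃ m (suc k) b′ ≈ (1# - γ * (q ^ m * q ^ m) * q) * poch q (γ * (q ^ m * q ^ m) * q * q) k
      den₃-sucᵏ′ m k = trans (poch-cong (suc k) shift) (poch-suc-head _ k)
        where
        shift : c * q ^ (2 ℕ.* m) / (a * b′) ≈ γ * (q ^ m * q ^ m) * q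
        shift = trans (cx/ab′≈γqx _) (trans (*-congˡ (*-congˡ (q^2m≈q^m*q^m m))) (solve 3 (λ g q Q → g :* (q :* Q) := g :* Q :* q) refl γ q _))

      den₃-sucᵐ′ : ∀ m k → den₃ (suc m) k b′ * (1# - γ * (q ^ m * q ^ m) * q * q) ≈ poch q (γ * (q ^ m * q ^ m) * q * q) k * (1# - γ * (q ^ m * q ^ m) * q * q * q ^ k)
      den₃-sucᵐ′ m k = begin
        poch q (c * q ^ (2 ℕ.* suc m) / (a * b′)) k * (1# - x)   ≈⟨ *-congʳ (poch-cong k shift) ⟩
        poch q (x * q) k * (1# - x)                              ≈⟨ *-comm _ _ ⟩
        (1# - x) * poch q (x * q) k                              ≈⟨ poch-suc-head x k ⟨
        poch q x k * (1# - x * q ^ k)                            ∎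
        where
        x : Carrier
        x = γ * (q ^ m * q ^ m) * q * q
        shift : c * q ^ (2 ℕ.* suc m) / (a * b′) ≈ x * q
        shift = trans (cx/ab′≈γqx _) (trans (*-congˡ (*-congˡ (q^2m≈q^m*q^m (suc m))))
          (solve 3 (λ g q Q → g :* (q :* ((q :* Q) :* (q :* Q))) := g :* (Q :* Q) :* q :* q :* q) refl γ q _))

      G : ℕ → ℕ → Carrier
      G m k = poch q q (suc (m ℕ.+ k)) * P q m b′ (u * q ^ (m ℕ.+ k)) * num₂ (suc m) k * num₃ m b′ * num₄ k

      H : ℕ → ℕ → Carrier
      H m k = poch q q k * poch q q m * den₁ (suc (m ℕ.+ k)) b′ * poch q (γ * q ^ m) m * poch q (γ * (q ^ m * q ^ m) * q * q) k

      g₀ g₁ g₂ h₀ h₁ h₂ : Carrier → Carrier → Carrier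
      g₀ Q K = (1# - q * (q * (Q * K))) * (q * Q * (b′ - u * (Q * K) * Q)) * (a - u * (q * Q) * K) * (u - γ * a) * (γ * (b′ * q) - u * K)
      g₁ Q K = (a - u * Q) * (γ * (b′ * q) - u * K)
      g₂ Q K = (b′ - u * (Q * K) * Q) * (u - γ * a * q * Q)
      h₀ Q K = (1# - q * K) * (1# - q * Q) * ((b′ * q - a) * (q * (Q * K))) * (1# - γ * (Q * Q)) * (1# - γ * (Q * Q) * q * q * K)
      h₁ Q K = (1# - q * K) * (1# - γ * (Q * Q) * q)
      h₂ Q K = (1# - q * Q) * ((1# - γ * (Q * Q)) * (1# - γ * (Q * Q) * q)) * (1# - γ * (Q * Q) * q * q * K)

      e : Carrier → Carrier
      e Q = (1# - γ * Q) * (1# - γ * (Q * Q) * q * q)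

      qfac-suc : ∀ m k → poch q q (suc (m ℕ.+ suc k)) ≈ poch q q (suc (m ℕ.+ k)) * (1# - q * (q * (q ^ m * q ^ k)))
      qfac-suc m k = trans (reflexive (≡.cong (λ j → poch q q (suc j)) (ℕ.+-suc m k)))
                           (*-congˡ (+-congˡ (-‿cong (*-congˡ (*-congˡ (^-distribˡ-+-* q m k))))))

      qnum-sucᵐᵏ : ∀ m k → qnum (suc m) (suc k) b ≈ G m k * g₀ (q ^ m) (q ^ k)
      qnum-sucᵐᵏ m k = begin
        poch q q (suc (m ℕ.+ suc k)) * (num₁ (suc m) (suc k) b * num₂ (suc m) (suc k) * num₃ (suc m) b * num₄ (suc k))
          ≈⟨ *-cong (qfac-suc m k) (*-cong (*-cong (*-cong (num₁-sucᵐᵏ m k) (num₂-sucᵏ m k)) (num₃-sucᵐ m)) (num₄-sucᵏ k)) ⟩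
        _ ≈⟨ solve 10 (λ A p N₁ n₁ N₂ n₂ n₃ N₃ N₄ n₄ → (A :* p) :* ((N₁ :* n₁) :* (N₂ :* n₂) :* (n₃ :* N₃) :* (N₄ :* n₄))
                                                := (A :* N₁ :* N₂ :* N₃ :* N₄) :* (p :* n₁ :* n₂ :* n₃ :* n₄)) refl _ _ _ _ _ _ _ _ _ _ ⟩
        G m k * g₀ (q ^ m) (q ^ k) ∎

      qnum-sucᵏ′ : ∀ m k → qnum m (suc k) b′ ≈ G m k * g₁ (q ^ m) (q ^ k)
      qnum-sucᵏ′ m k = begin
        poch q q (m ℕ.+ suc k) * (num₁ m (suc k) b′ * num₂ m (suc k) * num₃ m b′ * num₄ (suc k))
          ≈⟨ *-cong (reflexive (≡.cong (poch q q) (ℕ.+-suc m k))) (*-cong (*-congʳ (*-cong (num₁-index m k b′) (num₂-sucᵏ-head m k))) (num₄-sucᵏ k)) ⟩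
        _ ≈⟨ solve 7 (λ A N₁ n₂ N₂ N₃ N₄ n₄ → A :* (N₁ :* (n₂ :* N₂) :* N₃ :* (N₄ :* n₄)) := (A :* N₁ :* N₂ :* N₃ :* N₄) :* (n₂ :* n₄)) refl _ _ _ _ _ _ _ ⟩
        G m k * g₁ (q ^ m) (q ^ k) ∎

      qnum-sucᵐ′ : ∀ m k → qnum (suc m) k b′ ≈ G m k * g₂ (q ^ m) (q ^ k)
      qnum-sucᵐ′ m k = begin
        poch q q (suc (m ℕ.+ k)) * (num₁ (suc m) k b′ * num₂ (suc m) k * num₃ (suc m) b′ * num₄ k)
          ≈⟨ *-congˡ (*-congʳ (*-cong (*-congʳ (num₁-sucᵐ m k)) (num₃-sucᵐ′ m))) ⟩
        _ ≈⟨ solve 7 (λ A N₁ n₁ N₂ N₃ n₃ N₄ → A :* (N₁ :* n₁ :* N₂ :* (N₃ :* n₃) :* N₄) := (A :* N₁ :* N₂ :* N₃ :* N₄) :* (n₁ :* n₃)) refl _ _ _ _ _ _ _ ⟩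
        G m k * g₂ (q ^ m) (q ^ k) ∎

      qden-sucᵐᵏ : ∀ m k → qden (suc m) (suc k) b ≈ H m k * h₀ (q ^ m) (q ^ k)
      qden-sucᵐᵏ m k = begin
        poch q q (suc k) * poch q q (suc m) * (den₁ (suc (m ℕ.+ suc k)) b * den₂ (suc m) b * den₃ (suc m) (suc k) b)
          ≈⟨ *-congˡ (*-cong (*-cong den₁-sucᵐᵏ (den₂-sucᵐ m)) (den₃-sucᵐᵏ m k)) ⟩
        _ ≈⟨ solve 10 (λ A a₁ B b₁ D₁ d₁ D₂ d₂ D₃ d₃ → (A :* a₁) :* (B :* b₁) :* ((D₁ :* d₁) :* (D₂ :* d₂) :* (D₃ :* d₃))
                                                  := (A :* B :* D₁ :* D₂ :* D₃) :* (a₁ :* b₁ :* d₁ :* d₂ :* d₃)) refl _ _ _ _ _ _ _ _ _ _ ⟩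
        H m k * h₀ (q ^ m) (q ^ k) ∎
        where
        den₁-sucᵐᵏ : den₁ (suc (m ℕ.+ suc k)) b ≈ den₁ (suc (m ℕ.+ k)) b′ * ((b′ * q - a) * (q * (q ^ m * q ^ k)))
        den₁-sucᵐᵏ = begin
          den₁ (suc (m ℕ.+ suc k)) b   ≡⟨ ≡.cong (λ j → den₁ (suc j) b) (ℕ.+-suc m k) ⟩
          den₁ (suc (suc (m ℕ.+ k))) b ≈⟨ den₁-suc (suc (m ℕ.+ k)) ⟩
          den₁ (suc (m ℕ.+ k)) b′ * ((b′ * q - a) * (q * q ^ (m ℕ.+ k)))
            ≈⟨ *-congˡ (*-congˡ (*-congˡ (^-distribˡ-+-* q m k))) ⟩
          den₁ (suc (m ℕ.+ k)) b′ * ((b′ * q - a) * (q * (q ^ m * q ^ k))) ∎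

      qden-sucᵏ′ : ∀ m k → qden m (suc k) b′ ≈ H m k * h₁ (q ^ m) (q ^ k)
      qden-sucᵏ′ m k = begin
        poch q q (suc k) * poch q q m * (den₁ (m ℕ.+ suc k) b′ * den₂ m b′ * den₃ m (suc k) b′)
          ≈⟨ *-congˡ (*-cong (*-cong (reflexive (≡.cong (λ j → den₁ j b′) (ℕ.+-suc m k))) (den₂-b′ m)) (den₃-sucᵏ′ m k)) ⟩
        _ ≈⟨ solve 7 (λ A a₁ B D₁ D₂ d₃ D₃ → (A :* a₁) :* B :* (D₁ :* D₂ :* (d₃ :* D₃)) := (A :* B :* D₁ :* D₂ :* D₃) :* (a₁ :* d₃)) refl _ _ _ _ _ _ _ ⟩
        H m k * h₁ (q ^ m) (q ^ k) ∎

      qden-sucᵐ′ : ∀ m k → qden (suc m) k b′ * e (q ^ m) ≈ H m k * h₂ (q ^ m) (q ^ k)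
      qden-sucᵐ′ m k = begin
        poch q q k * poch q q (suc m) * (den₁ (suc (m ℕ.+ k)) b′ * den₂ (suc m) b′ * den₃ (suc m) k b′) * ((1# - γ * q ^ m) * (1# - γ * (q ^ m * q ^ m) * q * q))
          ≈⟨ solve 7 (λ A B D₁ D₂ D₃ e₁ e₂ → A :* B :* (D₁ :* D₂ :* D₃) :* (e₁ :* e₂) := A :* B :* (D₁ :* (D₂ :* e₁) :* (D₃ :* e₂))) refl _ _ _ _ _ _ _ ⟩
        _ ≈⟨ *-congˡ (*-cong (*-congˡ (den₂-sucᵐ′ m)) (den₃-sucᵐ′ m k)) ⟩
        _ ≈⟨ solve 8 (λ A B b₁ D₁ D₂ d₂ D₃ d₃ → (A :* (B :* b₁)) :* (D₁ :* (D₂ :* d₂) :* (D₃ :* d₃)) := (A :* B :* D₁ :* D₂ :* D₃) :* (b₁ :* d₂ :* d₃)) refl _ _ _ _ _ _ _ _ ⟩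
        H m k * h₂ (q ^ m) (q ^ k) ∎

      coeff-recurrence : ∀ m k → poch q q (suc k) ≉ 0# → poch q q (suc m) ≉ 0# →
        den (suc m) (suc k) b ≉ 0# → den m (suc k) b′ ≉ 0# → den (suc m) k b′ ≉ 0# →
        wA-den m ≉ 0# → wB-den (suc m) ≉ 0# → e (q ^ m) ≉ 0# →
        q ^ suc (m ℕ.+ k) * coeff (suc m) (suc k) b ≈ coeff m (suc k) b′ * wA m (suc k) + coeff (suc m) k b′ * wB (suc m) k
      coeff-recurrence m k [q]ₖ₊₁≉0 [q]ₘ₊₁≉0 den₀≉0 den₁≉0 den₂≉0 A≉0 B≉0 e≉0 = begin
        q ^ suc (m ℕ.+ k) * coeff (suc m) (suc k) b
          ≈⟨ *-congˡ (coeff≈qnum/qden (suc m) (suc k) b [q]ₖ₊₁≉0 [q]ₘ₊₁≉0 den₀≉0) ⟩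
        q ^ suc (m ℕ.+ k) * (qnum (suc m) (suc k) b / qden (suc m) (suc k) b)
          ≈⟨ *-assoc _ _ _ ⟨
        q ^ suc (m ℕ.+ k) * qnum (suc m) (suc k) b / qden (suc m) (suc k) b
          ≈⟨ /-≈-/-+-/ d≉0 qden₀*s≈d qden₁*s≈d qden₂*s≈d numerators ⟩
        qnum m (suc k) b′ * wA-num m (suc k) / (qden m (suc k) b′ * wA-den m)
          + qnum (suc m) k b′ * wB-num (suc m) k / (qden (suc m) k b′ * wB-den (suc m))
          ≈⟨ +-cong (trans (*-congʳ (coeff≈qnum/qden m (suc k) b′ [q]ₖ₊₁≉0 [q]ₘ≉0 den₁≉0)) (/-*-/ qden₁≉0 A≉0))
                    (trans (*-congʳ (coeff≈qnum/qden (suc m) k b′ [q]ₖ≉0 [q]ₘ₊₁≉0 den₂≉0)) (/-*-/ qden₂≉0 B≉0)) ⟨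
        coeff m (suc k) b′ * wA m (suc k) + coeff (suc m) k b′ * wB (suc m) k ∎
        where
        Q K : Carrier
        Q = q ^ m
        K = q ^ k

        [q]ₖ≉0 : poch q q k ≉ 0#
        [q]ₖ≉0 = *-≉0ˡ [q]ₖ₊₁≉0
        [q]ₘ≉0 : poch q q m ≉ 0#
        [q]ₘ≉0 = *-≉0ˡ [q]ₘ₊₁≉0
        qden₁≉0 : qden m (suc k) b′ ≉ 0#
        qden₁≉0 = *-≉0 (*-≉0 [q]ₖ₊₁≉0 [q]ₘ≉0) den₁≉0
        qden₂≉0 : qden (suc m) k b′ ≉ 0#
        qden₂≉0 = *-≉0 (*-≉0 [q]ₖ≉0 [q]ₘ₊₁≉0) den₂≉0

        D s₀ s₁ s₂′ s₂ : Carrier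
        D  = q * (Q * K) * (1# - q * K) * (1# - q * Q) * (b′ * q - a) * (1# - γ * (Q * Q))
             * (1# - γ * (Q * Q) * q * q * K) * (1# - γ * (Q * Q) * q) * (1# - γ * (Q * Q) * q * q)
        s₀ = (1# - γ * (Q * Q) * q) * (1# - γ * (Q * Q) * q * q)
        s₁ = - (q * (Q * K) * (1# - q * Q) * (1# - γ * (Q * Q) * q * q * K) * (1# - γ * (Q * Q) * q * q))
        s₂′ = q * (Q * K) * (1# - q * K)
        s₂ = e Q * s₂′

        h₀s₀≈D : h₀ Q K * s₀ ≈ D
        h₀s₀≈D = solve 7 (λ q Q K a b g z →
            (con (+ 1) :- q :* K) :* (con (+ 1) :- q :* Q) :* ((b :* q :- a) :* (q :* (Q :* K))) :* (con (+ 1) :- g :* (Q :* Q)) :* (con (+ 1) :- g :* (Q :* Q) :* q :* q :* K)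
              :* ((con (+ 1) :- g :* (Q :* Q) :* q) :* (con (+ 1) :- g :* (Q :* Q) :* q :* q))
          := q :* (Q :* K) :* (con (+ 1) :- q :* K) :* (con (+ 1) :- q :* Q) :* (b :* q :- a) :* (con (+ 1) :- g :* (Q :* Q))
              :* (con (+ 1) :- g :* (Q :* Q) :* q :* q :* K) :* (con (+ 1) :- g :* (Q :* Q) :* q) :* (con (+ 1) :- g :* (Q :* Q) :* q :* q))
          refl q Q K a b′ γ 0#

        h₁As₁≈D : h₁ Q K * wA-den m * s₁ ≈ D
        h₁As₁≈D = solve 6 (λ q Q K a b g →
            (con (+ 1) :- q :* K) :* (con (+ 1) :- g :* (Q :* Q) :* q) :* ((a :- b :* q) :* (con (+ 1) :- g :* (Q :* Q)))
              :* (:- (q :* (Q :* K) :* (con (+ 1) :- q :* Q) :* (con (+ 1) :- g :* (Q :* Q) :* q :* q :* K) :* (con (+ 1) :- g :* (Q :* Q) :* q :* q)))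
          := q :* (Q :* K) :* (con (+ 1) :- q :* K) :* (con (+ 1) :- q :* Q) :* (b :* q :- a) :* (con (+ 1) :- g :* (Q :* Q))
              :* (con (+ 1) :- g :* (Q :* Q) :* q :* q :* K) :* (con (+ 1) :- g :* (Q :* Q) :* q) :* (con (+ 1) :- g :* (Q :* Q) :* q :* q))
          refl q Q K a b′ γ

        h₂Bs₂′≈D : h₂ Q K * wB-den (suc m) * s₂′ ≈ D
        h₂Bs₂′≈D = solve 6 (λ q Q K a b g →
            (con (+ 1) :- q :* Q) :* ((con (+ 1) :- g :* (Q :* Q)) :* (con (+ 1) :- g :* (Q :* Q) :* q)) :* (con (+ 1) :- g :* (Q :* Q) :* q :* q :* K)
              :* ((b :* q :- a) :* (con (+ 1) :- g :* ((q :* Q) :* (q :* Q)))) :* (q :* (Q :* K) :* (con (+ 1) :- q :* K))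
          := q :* (Q :* K) :* (con (+ 1) :- q :* K) :* (con (+ 1) :- q :* Q) :* (b :* q :- a) :* (con (+ 1) :- g :* (Q :* Q))
              :* (con (+ 1) :- g :* (Q :* Q) :* q :* q :* K) :* (con (+ 1) :- g :* (Q :* Q) :* q) :* (con (+ 1) :- g :* (Q :* Q) :* q :* q))
          refl q Q K a b′ γ

        -- What is left of the recurrence once the common factors G and H cancel.
        cofactors : q * (Q * K) * g₀ Q K * s₀ ≈ g₁ Q K * wA-num m (suc k) * s₁ + g₂ Q K * wB-num (suc m) k * s₂
        cofactors = solve 7 (λ q Q K u a b g →
            q :* (Q :* K) :* ((con (+ 1) :- q :* (q :* (Q :* K))) :* (q :* Q :* (b :- u :* (Q :* K) :* Q)) :* (a :- u :* (q :* Q) :* K) :* (u :- g :* a) :* (g :* (b :* q) :- u :* K))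
              :* ((con (+ 1) :- g :* (Q :* Q) :* q) :* (con (+ 1) :- g :* (Q :* Q) :* q :* q))
          := (a :- u :* Q) :* (g :* (b :* q) :- u :* K) :* (Q :* (u :* (Q :* (q :* K)) :* Q :- b :* q) :* (u :* (q :* K) :- g :* a))
              :* (:- (q :* (Q :* K) :* (con (+ 1) :- q :* Q) :* (con (+ 1) :- g :* (Q :* Q) :* q :* q :* K) :* (con (+ 1) :- g :* (Q :* Q) :* q :* q)))
             :+ (b :- u :* (Q :* K) :* Q) :* (u :- g :* a :* q :* Q) :* (q :* Q :* (u :* (q :* Q :* K) :* (q :* Q) :- a) :* (u :* K :- g :* (b :* q)))
              :* ((con (+ 1) :- g :* Q) :* (con (+ 1) :- g :* (Q :* Q) :* q :* q) :* (q :* (Q :* K) :* (con (+ 1) :- q :* K))))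
          refl q Q K u a b′ γ

        qden₀*s≈d : qden (suc m) (suc k) b * s₀ ≈ H m k * D
        qden₀*s≈d = trans (*-congʳ (qden-sucᵐᵏ m k)) (trans (*-assoc _ _ _) (*-congˡ h₀s₀≈D))

        qden₁*s≈d : qden m (suc k) b′ * wA-den m * s₁ ≈ H m k * D
        qden₁*s≈d = begin
          qden m (suc k) b′ * wA-den m * s₁     ≈⟨ *-congʳ (*-congʳ (qden-sucᵏ′ m k)) ⟩
          H m k * h₁ Q K * wA-den m * s₁        ≈⟨ solve 4 (λ H h w s → H :* h :* w :* s := H :* (h :* w :* s)) refl _ _ _ _ ⟩
          H m k * (h₁ Q K * wA-den m * s₁)      ≈⟨ *-congˡ h₁As₁≈D ⟩
          H m k * D                             ∎

        qden₂*s≈d : qden (suc m) k b′ * wB-den (suc m) * s₂ ≈ H m k * D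
        qden₂*s≈d = begin
          qden (suc m) k b′ * wB-den (suc m) * (e Q * s₂′)
            ≈⟨ solve 4 (λ x w e s → x :* w :* (e :* s) := x :* e :* (w :* s)) refl _ _ _ _ ⟩
          qden (suc m) k b′ * e Q * (wB-den (suc m) * s₂′)
            ≈⟨ *-congʳ (qden-sucᵐ′ m k) ⟩
          H m k * h₂ Q K * (wB-den (suc m) * s₂′)
            ≈⟨ solve 4 (λ H h w s → H :* h :* (w :* s) := H :* (h :* w :* s)) refl _ _ _ _ ⟩
          H m k * (h₂ Q K * wB-den (suc m) * s₂′)
            ≈⟨ *-congˡ h₂Bs₂′≈D ⟩
          H m k * D ∎

        numerators : q ^ suc (m ℕ.+ k) * qnum (suc m) (suc k) b * s₀
                     ≈ qnum m (suc k) b′ * wA-num m (suc k) * s₁ + qnum (suc m) k b′ * wB-num (suc m) k * s₂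
        numerators = begin
          q ^ suc (m ℕ.+ k) * qnum (suc m) (suc k) b * s₀
            ≈⟨ *-congʳ (*-cong (*-congˡ (^-distribˡ-+-* q m k)) (qnum-sucᵐᵏ m k)) ⟩
          q * (Q * K) * (G m k * g₀ Q K) * s₀
            ≈⟨ solve 4 (λ x G g s → x :* (G :* g) :* s := G :* (x :* g :* s)) refl _ _ _ _ ⟩
          G m k * (q * (Q * K) * g₀ Q K * s₀)
            ≈⟨ *-congˡ cofactors ⟩
          G m k * (g₁ Q K * wA-num m (suc k) * s₁ + g₂ Q K * wB-num (suc m) k * s₂)
            ≈⟨ solve 7 (λ G g₁ α s₁ g₂ β s₂ → G :* (g₁ :* α :* s₁ :+ g₂ :* β :* s₂) := G :* g₁ :* α :* s₁ :+ G :* g₂ :* β :* s₂) refl _ _ _ _ _ _ _ ⟩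
          G m k * g₁ Q K * wA-num m (suc k) * s₁ + G m k * g₂ Q K * wB-num (suc m) k * s₂
            ≈⟨ +-cong (*-congʳ (*-congʳ (qnum-sucᵏ′ m k))) (*-congʳ (*-congʳ (qnum-sucᵐ′ m k))) ⟨
          qnum m (suc k) b′ * wA-num m (suc k) * s₁ + qnum (suc m) k b′ * wB-num (suc m) k * s₂ ∎

        d≉0 : H m k * D ≉ 0#
        d≉0 = ≉0-resp-≈ qden₂*s≈d (*-≉0 (*-≉0 qden₂≉0 B≉0) (*-≉0 e≉0 (*-≉0 (*-≉0 q≉0 (*-≉0 (^-≉0 m q≉0) (^-≉0 k q≉0))) (*-≉0ʳ [q]ₖ₊₁≉0))))

      coeff-recurrence-k≡0 : ∀ m → poch q q (suc m) ≉ 0# → den (suc m) 0 b ≉ 0# → den m 0 b′ ≉ 0# → wA-den m ≉ 0# →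
                             q ^ m * coeff (suc m) 0 b ≈ coeff m 0 b′ * wA m 0
      coeff-recurrence-k≡0 m [q]ₘ₊₁≉0 den₀≉0 den₁≉0 A≉0 = begin
        q ^ m * coeff (suc m) 0 b
          ≈⟨ *-congˡ (coeff≈qnum/qden (suc m) 0 b 1≉0 [q]ₘ₊₁≉0 den₀≉0) ⟩
        q ^ m * (qnum (suc m) 0 b / qden (suc m) 0 b)
          ≈⟨ *-assoc _ _ _ ⟨
        q ^ m * qnum (suc m) 0 b / qden (suc m) 0 b
          ≈⟨ /-≈-/ (≉0-resp-≈ qden₀*1≈d (*-≉0 qden₀≉0 1≉0)) qden₀*1≈d qden₁*t≈d numerators ⟩
        qnum m 0 b′ * wA-num m 0 / (qden m 0 b′ * wA-den m)
          ≈⟨ trans (*-congʳ (coeff≈qnum/qden m 0 b′ 1≉0 [q]ₘ≉0 den₁≉0)) (/-*-/ (*-≉0 (*-≉0 1≉0 [q]ₘ≉0) den₁≉0) A≉0) ⟨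
        coeff m 0 b′ * wA m 0 ∎
        where
        Q : Carrier
        Q = q ^ m

        [q]ₘ≉0 : poch q q m ≉ 0#
        [q]ₘ≉0 = *-≉0ˡ [q]ₘ₊₁≉0
        qden₀≉0 : qden (suc m) 0 b ≉ 0#
        qden₀≉0 = *-≉0 (*-≉0 1≉0 [q]ₘ₊₁≉0) den₀≉0

        m+0≡m : m ℕ.+ 0 ≡ m
        m+0≡m = ℕ.+-identityʳ m

        num₁-k≡0 : num₁ (suc m) 0 b ≈ num₁ m 0 b′ * (Q * (b′ * q - u * Q * Q))
        num₁-k≡0 = begin
          P q (suc m) b (u * q ^ (m ℕ.+ 0))    ≡⟨ ≡.cong (λ j → P q (suc m) b (u * q ^ j)) m+0≡m ⟩
          P q (suc m) b (u * Q)                ≈⟨ P-suc m _ b≉0 ⟩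
          P q m b (u * Q) * (b - u * Q * Q)    ≈⟨ *-cong (scale m) (+-congʳ b≈b′q) ⟩
          Q * P q m b′ (u * q ^ (m ∸ 1)) * (b′ * q - u * Q * Q)
            ≈⟨ solve 3 (λ Q p x → Q :* p :* x := p :* (Q :* x)) refl _ _ _ ⟩
          P q m b′ (u * q ^ (m ∸ 1)) * (Q * (b′ * q - u * Q * Q))
            ≡⟨ ≡.cong (λ j → P q m b′ (u * q ^ (j ∸ 1)) * (Q * (b′ * q - u * Q * Q))) m+0≡m ⟨
          num₁ m 0 b′ * (Q * (b′ * q - u * Q * Q)) ∎
          where
          scale : ∀ m → P q m b (u * q ^ m) ≈ q ^ m * P q m b′ (u * q ^ (m ∸ 1))
          scale zero    = sym (*-identityˡ _)
          scale (suc m) = trans (P-cong (suc m) b≈qb′ (solve 3 (λ u q Q → u :* (q :* Q) := q :* (u :* Q)) refl u q _))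
                                (P-homogeneous (suc m) _ q≉0 b′≉0)

        G′ H′ : Carrier
        G′ = poch q q m * num₁ m 0 b′ * num₃ m b′
        H′ = poch q q m * den₁ m b′ * poch q (γ * Q) m

        qnum₀≈ : qnum (suc m) 0 b ≈ G′ * ((1# - q * Q) * (Q * (b′ * q - u * Q * Q)) * (u - γ * a))
        qnum₀≈ = begin
          poch q q (suc (m ℕ.+ 0)) * (num₁ (suc m) 0 b * (1# * 1#) * num₃ (suc m) b * (1# * 1#))
            ≡⟨ ≡.cong (λ j → poch q q (suc j) * (num₁ (suc m) 0 b * (1# * 1#) * num₃ (suc m) b * (1# * 1#))) m+0≡m ⟩
          poch q q m * (1# - q * Q) * (num₁ (suc m) 0 b * (1# * 1#) * num₃ (suc m) b * (1# * 1#))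
            ≈⟨ *-congˡ (*-congʳ (*-congʳ (*-congʳ num₁-k≡0))) ⟩
          _ ≈⟨ *-congˡ (*-congʳ (*-congˡ (num₃-sucᵐ m))) ⟩
          _ ≈⟨ solve 6 (λ A a₁ N₁ n₁ n₃ N₃ → A :* a₁ :* (N₁ :* n₁ :* (con (+ 1) :* con (+ 1)) :* (n₃ :* N₃) :* (con (+ 1) :* con (+ 1)))
                                           := A :* N₁ :* N₃ :* (a₁ :* n₁ :* n₃)) refl _ _ _ _ _ _ ⟩
          G′ * ((1# - q * Q) * (Q * (b′ * q - u * Q * Q)) * (u - γ * a)) ∎

        qnum₁≈ : qnum m 0 b′ ≈ G′
        qnum₁≈ = begin
          poch q q (m ℕ.+ 0) * (num₁ m 0 b′ * (1# * 1#) * num₃ m b′ * (1# * 1#))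
            ≡⟨ ≡.cong (λ j → poch q q j * (num₁ m 0 b′ * (1# * 1#) * num₃ m b′ * (1# * 1#))) m+0≡m ⟩
          poch q q m * (num₁ m 0 b′ * (1# * 1#) * num₃ m b′ * (1# * 1#))
            ≈⟨ solve 3 (λ A N₁ N₃ → A :* (N₁ :* (con (+ 1) :* con (+ 1)) :* N₃ :* (con (+ 1) :* con (+ 1))) := A :* N₁ :* N₃ :* (con (+ 1) :* con (+ 1) :* con (+ 1) :* con (+ 1))) refl _ _ _ ⟩
          G′ * (1# * 1# * 1# * 1#)
            ≈⟨ *-congˡ (solve 0 (con (+ 1) :* con (+ 1) :* con (+ 1) :* con (+ 1) := con (+ 1)) refl) ⟩
          G′ * 1#
            ≈⟨ *-identityʳ G′ ⟩
          G′ ∎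

        qden₀≈ : qden (suc m) 0 b ≈ H′ * ((1# - q * Q) * ((b′ * q - a) * Q) * (1# - γ * (Q * Q)))
        qden₀≈ = begin
          1# * (poch q q m * (1# - q * Q)) * (den₁ (suc (m ℕ.+ 0)) b * den₂ (suc m) b * 1#)
            ≡⟨ ≡.cong (λ j → 1# * (poch q q m * (1# - q * Q)) * (den₁ (suc j) b * den₂ (suc m) b * 1#)) m+0≡m ⟩
          1# * (poch q q m * (1# - q * Q)) * (den₁ (suc m) b * den₂ (suc m) b * 1#)
            ≈⟨ *-congˡ (*-congʳ (*-cong (den₁-suc m) (den₂-sucᵐ m))) ⟩
          _ ≈⟨ solve 6 (λ A a₁ D₁ d₁ D₂ d₂ → con (+ 1) :* (A :* a₁) :* (D₁ :* d₁ :* (D₂ :* d₂) :* con (+ 1)) := A :* D₁ :* D₂ :* (a₁ :* d₁ :* d₂)) refl _ _ _ _ _ _ ⟩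
          H′ * ((1# - q * Q) * ((b′ * q - a) * Q) * (1# - γ * (Q * Q))) ∎

        qden₁≈ : qden m 0 b′ ≈ H′
        qden₁≈ = begin
          1# * poch q q m * (den₁ (m ℕ.+ 0) b′ * den₂ m b′ * 1#)
            ≡⟨ ≡.cong (λ j → 1# * poch q q m * (den₁ j b′ * den₂ m b′ * 1#)) m+0≡m ⟩
          1# * poch q q m * (den₁ m b′ * den₂ m b′ * 1#)
            ≈⟨ *-congˡ (*-congʳ (*-congˡ (den₂-b′ m))) ⟩
          1# * poch q q m * (den₁ m b′ * poch q (γ * Q) m * 1#)
            ≈⟨ solve 3 (λ A D₁ D₂ → con (+ 1) :* A :* (D₁ :* D₂ :* con (+ 1)) := A :* D₁ :* D₂ :* (con (+ 1) :* con (+ 1))) refl _ _ _ ⟩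
          H′ * (1# * 1#)
            ≈⟨ *-congˡ (*-identityʳ 1#) ⟩
          H′ * 1#
            ≈⟨ *-identityʳ H′ ⟩
          H′ ∎

        t : Carrier
        t = - ((1# - q * Q) * Q)

        qden₀*1≈d : qden (suc m) 0 b * 1# ≈ H′ * ((1# - q * Q) * ((b′ * q - a) * Q) * (1# - γ * (Q * Q)))
        qden₀*1≈d = trans (*-identityʳ _) qden₀≈

        qden₁*t≈d : qden m 0 b′ * wA-den m * t ≈ H′ * ((1# - q * Q) * ((b′ * q - a) * Q) * (1# - γ * (Q * Q)))
        qden₁*t≈d = begin
          qden m 0 b′ * wA-den m * t ≈⟨ *-congʳ (*-congʳ qden₁≈) ⟩
          H′ * wA-den m * t           ≈⟨ solve 6 (λ H′ q Q a b g →
              H′ :* ((a :- b :* q) :* (con (+ 1) :- g :* (Q :* Q))) :* (:- ((con (+ 1) :- q :* Q) :* Q))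
              := H′ :* ((con (+ 1) :- q :* Q) :* ((b :* q :- a) :* Q) :* (con (+ 1) :- g :* (Q :* Q)))) refl H′ q Q a b′ γ ⟩
          H′ * ((1# - q * Q) * ((b′ * q - a) * Q) * (1# - γ * (Q * Q))) ∎

        numerators : q ^ m * qnum (suc m) 0 b * 1# ≈ qnum m 0 b′ * wA-num m 0 * t
        numerators = begin
          Q * qnum (suc m) 0 b * 1#   ≈⟨ *-congʳ (*-congˡ qnum₀≈) ⟩
          Q * (G′ * ((1# - q * Q) * (Q * (b′ * q - u * Q * Q)) * (u - γ * a))) * 1#
            ≈⟨ solve 7 (λ G′ q Q u a b g →
                 Q :* (G′ :* ((con (+ 1) :- q :* Q) :* (Q :* (b :* q :- u :* Q :* Q)) :* (u :- g :* a))) :* con (+ 1)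
                 := G′ :* (Q :* (u :* (Q :* con (+ 1)) :* Q :- b :* q) :* (u :* con (+ 1) :- g :* a)) :* (:- ((con (+ 1) :- q :* Q) :* Q)))
               refl G′ q Q u a b′ γ ⟩
          G′ * wA-num m 0 * t          ≈⟨ *-congʳ (*-congʳ qnum₁≈) ⟨
          qnum m 0 b′ * wA-num m 0 * t ∎

      coeff-recurrence-m≡0 : ∀ k → poch q q (suc k) ≉ 0# → den 0 (suc k) b ≉ 0# → den 0 k b′ ≉ 0# → wB-den 0 ≉ 0# →
                             q ^ k * coeff 0 (suc k) b ≈ coeff 0 k b′ * wB 0 k
      coeff-recurrence-m≡0 k [q]ₖ₊₁≉0 den₀≉0 den₁≉0 B≉0 = begin
        q ^ k * coeff 0 (suc k) b
          ≈⟨ *-congˡ (coeff≈qnum/qden 0 (suc k) b [q]ₖ₊₁≉0 1≉0 den₀≉0) ⟩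
        q ^ k * (qnum 0 (suc k) b / qden 0 (suc k) b)
          ≈⟨ *-assoc _ _ _ ⟨
        q ^ k * qnum 0 (suc k) b / qden 0 (suc k) b
          ≈⟨ /-≈-/ (≉0-resp-≈ qden₀*1≈d (*-≉0 qden₀≉0 1≉0)) qden₀*1≈d qden₁*t≈d numerators ⟩
        qnum 0 k b′ * wB-num 0 k / (qden 0 k b′ * wB-den 0)
          ≈⟨ trans (*-congʳ (coeff≈qnum/qden 0 k b′ [q]ₖ≉0 1≉0 den₁≉0)) (/-*-/ (*-≉0 (*-≉0 [q]ₖ≉0 1≉0) den₁≉0) B≉0) ⟨
        coeff 0 k b′ * wB 0 k ∎
        where
        K : Carrier
        K = q ^ k

        [q]ₖ≉0 : poch q q k ≉ 0#
        [q]ₖ≉0 = *-≉0ˡ [q]ₖ₊₁≉0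
        qden₀≉0 : qden 0 (suc k) b ≉ 0#
        qden₀≉0 = *-≉0 (*-≉0 [q]ₖ₊₁≉0 1≉0) den₀≉0

        G′ H′ : Carrier
        G′ = poch q q k * num₂ 0 k * num₄ k
        H′ = poch q q k * den₁ k b′ * poch q (γ * q) k

        qnum₀≈ : qnum 0 (suc k) b ≈ G′ * ((1# - q * K) * (a - u * 1# * K) * (γ * (b′ * q) - u * K))
        qnum₀≈ = begin
          poch q q (suc k) * (1# * 1# * num₂ 0 (suc k) * (1# * 1#) * num₄ (suc k))
            ≈⟨ *-congˡ (*-cong (*-congʳ (*-congˡ (P-suc k _ a≉0))) (num₄-sucᵏ k)) ⟩
          _ ≈⟨ solve 6 (λ A a₁ N₂ n₂ N₄ n₄ → A :* a₁ :* (con (+ 1) :* con (+ 1) :* (N₂ :* n₂) :* (con (+ 1) :* con (+ 1)) :* (N₄ :* n₄))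
                                          := A :* N₂ :* N₄ :* (a₁ :* n₂ :* n₄)) refl _ _ _ _ _ _ ⟩
          G′ * ((1# - q * K) * (a - u * 1# * K) * (γ * (b′ * q) - u * K)) ∎

        qnum₁≈ : qnum 0 k b′ ≈ G′
        qnum₁≈ = begin
          poch q q k * (1# * 1# * num₂ 0 k * (1# * 1#) * num₄ k)
            ≈⟨ solve 3 (λ A N₂ N₄ → A :* (con (+ 1) :* con (+ 1) :* N₂ :* (con (+ 1) :* con (+ 1)) :* N₄) := A :* N₂ :* N₄) refl _ _ _ ⟩
          G′ ∎

        qden₀≈ : qden 0 (suc k) b ≈ H′ * ((1# - q * K) * ((b′ * q - a) * K) * (1# - γ))
        qden₀≈ = begin
          poch q q (suc k) * 1# * (den₁ (suc k) b * 1# * den₃ 0 (suc k) b)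
            ≈⟨ *-congˡ (*-cong (*-congʳ (den₁-suc k)) den₃-suc) ⟩
          _ ≈⟨ solve 6 (λ A a₁ D₁ d₁ d₃ D₃ → A :* a₁ :* con (+ 1) :* (D₁ :* d₁ :* con (+ 1) :* (d₃ :* D₃))
                                          := A :* D₁ :* D₃ :* (a₁ :* d₁ :* d₃)) refl _ _ _ _ _ _ ⟩
          H′ * ((1# - q * K) * ((b′ * q - a) * K) * (1# - γ)) ∎
          where
          den₃-suc : den₃ 0 (suc k) b ≈ (1# - γ) * poch q (γ * q) k
          den₃-suc = trans (poch-cong (suc k) (trans (cx/ab≈γx 1#) (*-identityʳ γ))) (poch-suc-head γ k)

        qden₁≈ : qden 0 k b′ ≈ H′
        qden₁≈ = begin
          poch q q k * 1# * (den₁ k b′ * 1# * den₃ 0 k b′)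
            ≈⟨ *-congˡ (*-congˡ (poch-cong k (trans (cx/ab′≈γqx 1#) (*-congˡ (*-identityʳ q))))) ⟩
          poch q q k * 1# * (den₁ k b′ * 1# * poch q (γ * q) k)
            ≈⟨ solve 3 (λ A D₁ D₃ → A :* con (+ 1) :* (D₁ :* con (+ 1) :* D₃) := A :* D₁ :* D₃) refl _ _ _ ⟩
          H′ ∎

        t : Carrier
        t = (1# - q * K) * K

        qden₀*1≈d : qden 0 (suc k) b * 1# ≈ H′ * ((1# - q * K) * ((b′ * q - a) * K) * (1# - γ))
        qden₀*1≈d = trans (*-identityʳ _) qden₀≈

        qden₁*t≈d : qden 0 k b′ * wB-den 0 * t ≈ H′ * ((1# - q * K) * ((b′ * q - a) * K) * (1# - γ))
        qden₁*t≈d = begin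
          qden 0 k b′ * wB-den 0 * t ≈⟨ *-congʳ (*-congʳ qden₁≈) ⟩
          H′ * wB-den 0 * t          ≈⟨ solve 6 (λ H q K a b g →
              H :* ((b :* q :- a) :* (con (+ 1) :- g :* (con (+ 1) :* con (+ 1)))) :* ((con (+ 1) :- q :* K) :* K)
              := H :* ((con (+ 1) :- q :* K) :* ((b :* q :- a) :* K) :* (con (+ 1) :- g))) refl H′ q K a b′ γ ⟩
          H′ * ((1# - q * K) * ((b′ * q - a) * K) * (1# - γ)) ∎

        numerators : q ^ k * qnum 0 (suc k) b * 1# ≈ qnum 0 k b′ * wB-num 0 k * t
        numerators = begin
          K * qnum 0 (suc k) b * 1#   ≈⟨ *-congʳ (*-congˡ qnum₀≈) ⟩
          K * (G′ * ((1# - q * K) * (a - u * 1# * K) * (γ * (b′ * q) - u * K))) * 1#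
            ≈⟨ solve 7 (λ G q K u a b g →
                 K :* (G :* ((con (+ 1) :- q :* K) :* (a :- u :* con (+ 1) :* K) :* (g :* (b :* q) :- u :* K))) :* con (+ 1)
                 := G :* (con (+ 1) :* (u :* (con (+ 1) :* K) :* con (+ 1) :- a) :* (u :* K :- g :* (b :* q))) :* ((con (+ 1) :- q :* K) :* K))
               refl G′ q K u a b′ γ ⟩
          G′ * wB-num 0 k * t         ≈⟨ *-congʳ (*-congʳ qnum₁≈) ⟨
          qnum 0 k b′ * wB-num 0 k * t ∎

      den₃-suc-head : ∀ m k → den₃ m (suc k) b ≈ (1# - γ * q ^ (2 ℕ.* m)) * den₃ m k b′
      den₃-suc-head m k = trans (poch-suc-head _ k) (*-cong (+-congˡ (-‿cong (cx/ab≈γx _))) (poch-cong k shift))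
        where
        shift : c * q ^ (2 ℕ.* m) / (a * b) * q ≈ c * q ^ (2 ℕ.* m) / (a * b′)
        shift = trans (*-congʳ (cx/ab≈γx _)) (trans (solve 3 (λ g X q → g :* X :* q := g :* (q :* X)) refl γ _ q) (sym (cx/ab′≈γqx _)))

    module Step (n : ℕ) (b : Carrier) (b≉0 : b ≉ 0#) (nd : Nondegenerate (suc n) b) where
      open Shift b b≉0 public
      open Nondegenerate nd

      b′q-a≉0 : b′ * q - a ≉ 0#
      b′q-a≉0 = *-≉0ˡ (*-≉0ʳ (≉0-resp-≈ (den₁-suc n) den₁≉0))

      den₂-suc≉0 : ∀ m → m ≤ n → den₂ (suc m) b ≉ 0#
      den₂-suc≉0 m m≤n = den₂≉0 (suc m) (n ∸ m) (≡.cong suc (ℕ.m+[n∸m]≡n m≤n))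

      1-γq^2m≉0 : ∀ m → m ≤ n → 1# - γ * (q ^ m * q ^ m) ≉ 0#
      1-γq^2m≉0 m m≤n = *-≉0ʳ (≉0-resp-≈ (den₂-sucᵐ m) (den₂-suc≉0 m m≤n))

      wA-den≉0 : ∀ m → m ≤ n → wA-den m ≉ 0#
      wA-den≉0 m m≤n = *-≉0 (x-y≉0⇒y-x≉0 b′q-a≉0) (1-γq^2m≉0 m m≤n)

      wB-den≉0 : ∀ m → m ≤ n → wB-den m ≉ 0#
      wB-den≉0 m m≤n = *-≉0 b′q-a≉0 (1-γq^2m≉0 m m≤n)

      e≉0 : ∀ m k → suc (m ℕ.+ k) ≡ n → e (q ^ m) ≉ 0#
      e≉0 m k 1+m+k≡n = *-≉0 1-γq^m≉0 1-γq^[2m+2]≉0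
        where
        1-γq^m≉0 : 1# - γ * q ^ m ≉ 0#
        1-γq^m≉0 = *-≉0ˡ (≉0-resp-≈ (trans (poch-cong (suc m) (cx/ab≈γx _)) (poch-suc-head _ m))
                                     (den₂-suc≉0 m (ℕ.<⇒≤ (ℕ.≤-trans (s≤s (ℕ.m≤m+n m k)) (ℕ.≤-reflexive 1+m+k≡n)))))
        1-γq^[2m+2]≉0 : 1# - γ * (q ^ m * q ^ m) * q * q ≉ 0#
        1-γq^[2m+2]≉0 = *-≉0ˡ (≉0-resp-≈ (trans (den₃-suc-head (suc m) k) (*-congʳ (+-congˡ (-‿cong square))))
                                       (den₃≉0 (suc m) (suc k) (≡.cong suc (≡.trans (ℕ.+-suc m k) 1+m+k≡n))))
          where
          square : γ * q ^ (2 ℕ.* suc m) ≈ γ * (q ^ m * q ^ m) * q * q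
          square = trans (*-congˡ (q^2m≈q^m*q^m (suc m))) (solve 3 (λ g q Q → g :* ((q :* Q) :* (q :* Q)) := g :* (Q :* Q) :* q :* q) refl γ q _)

      nondegenerate′ : Nondegenerate n b′
      nondegenerate′ = record
        { qfac≉0 = λ j j≤n → qfac≉0 j (ℕ.m≤n⇒m≤1+n j≤n)
        ; den₁≉0 = *-≉0ˡ (≉0-resp-≈ (den₁-suc n) den₁≉0)
        ; den₂≉0 = λ m k m+k≡n → ≉0-resp-≈ (sym (den₂-b′ m)) (*-≉0ˡ (≉0-resp-≈ (den₂-sucᵐ m) (den₂≉0 (suc m) k (≡.cong suc m+k≡n))))
        ; den₃≉0 = λ m k m+k≡n → *-≉0ʳ (≉0-resp-≈ (den₃-suc-head m k) (den₃≉0 m (suc k) (≡.trans (ℕ.+-suc m k) (≡.cong suc m+k≡n))))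
        }

      raiseᵐ raiseᵏ : ℕ → ℕ → Carrier
      raiseᵐ m k = coeff m k b′ * wA m k * basis (suc m) k b
      raiseᵏ m k = coeff m k b′ * wB m k * basis m (suc k) b

      raiseᵐₙ raiseᵏₙ : ℕ → Carrier
      raiseᵐₙ k = raiseᵐ (n ∸ k) k
      raiseᵏₙ k = raiseᵏ (n ∸ k) k

      term*factor : ∀ k → k ≤ n → term (n ∸ k) k b′ * factor n ≈ raiseᵐₙ k + raiseᵏₙ k
      term*factor k k≤n = begin
        term m k b′ * factor n                     ≈⟨ *-cong (term≈coeff*basis m k b′) (reflexive (≡.cong factor (≡.sym (ℕ.m∸n+n≡m k≤n)))) ⟩
        coeff m k b′ * basis m k b′ * factor (m ℕ.+ k) ≈⟨ *-assoc _ _ _ ⟩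
        coeff m k b′ * (basis m k b′ * factor (m ℕ.+ k))
          ≈⟨ *-congˡ (basis-factor m k (wA-den≉0 m (ℕ.m∸n≤m n k)) (wB-den≉0 m (ℕ.m∸n≤m n k))) ⟩
        coeff m k b′ * (wA m k * basis (suc m) k b + wB m k * basis m (suc k) b)
          ≈⟨ solve 5 (λ C α B β B′ → C :* (α :* B :+ β :* B′) := C :* α :* B :+ C :* β :* B′) refl _ _ _ _ _ ⟩
        raiseᵐₙ k + raiseᵏₙ k ∎
        where
        m : ℕ
        m = n ∸ k

      scaled-term : ∀ m k {x z} → x * coeff m k b ≈ z → x * term m k b ≈ z * basis m k b
      scaled-term m k x*coeff≈z = trans (*-congˡ (term≈coeff*basis m k b)) (trans (sym (*-assoc _ _ _)) (*-congʳ x*coeff≈z))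

      interior : ∀ m k → suc (m ℕ.+ k) ≡ n → q ^ suc (m ℕ.+ k) * term (suc m) (suc k) b ≈ raiseᵐ m (suc k) + raiseᵏ (suc m) k
      interior m k 1+m+k≡n = trans (scaled-term (suc m) (suc k) (coeff-recurrence m k
          (qfac≉0 (suc k) (ℕ.m≤n⇒m≤1+n (ℕ.≤-trans (s≤s (ℕ.m≤n+m k m)) (ℕ.≤-reflexive 1+m+k≡n))))
          (qfac≉0 (suc m) (ℕ.m≤n⇒m≤1+n sm≤n))
          (den≉0 nd (suc m) (suc k) (≡.cong suc (≡.trans (ℕ.+-suc m k) 1+m+k≡n)))
          (den≉0 nondegenerate′ m (suc k) (≡.trans (ℕ.+-suc m k) 1+m+k≡n))
          (den≉0 nondegenerate′ (suc m) k 1+m+k≡n)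
          (wA-den≉0 m (ℕ.<⇒≤ sm≤n)) (wB-den≉0 (suc m) sm≤n) (e≉0 m k 1+m+k≡n)))
        (distribʳ _ _ _)
        where
        sm≤n : suc m ≤ n
        sm≤n = ℕ.≤-trans (s≤s (ℕ.m≤m+n m k)) (ℕ.≤-reflexive 1+m+k≡n)

      boundary-k≡0 : q ^ n * term (suc n) 0 b ≈ raiseᵐ n 0
      boundary-k≡0 = scaled-term (suc n) 0 (coeff-recurrence-k≡0 n (qfac≉0 (suc n) ℕ.≤-refl)
        (den≉0 nd (suc n) 0 (ℕ.+-identityʳ (suc n))) (den≉0 nondegenerate′ n 0 (ℕ.+-identityʳ n)) (wA-den≉0 n ℕ.≤-refl))

      boundary-m≡0 : q ^ n * term 0 (suc n) b ≈ raiseᵏ 0 n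
      boundary-m≡0 = scaled-term 0 (suc n) (coeff-recurrence-m≡0 n (qfac≉0 (suc n) ℕ.≤-refl)
        (den≉0 nd 0 (suc n) ≡.refl) (den≉0 nondegenerate′ 0 n ≡.refl) (wB-den≉0 0 z≤n))

      sum-step : sumTo n (λ k → term (n ∸ k) k b′) * factor n ≈ q ^ n * sumTo (suc n) (λ k → term (suc n ∸ k) k b)
      sum-step = begin
        sumTo n (λ k → term (n ∸ k) k b′) * factor n       ≈⟨ *-distribʳ-sumTo n (factor n) _ ⟩
        sumTo n (λ k → term (n ∸ k) k b′ * factor n)       ≈⟨ sumTo-cong n term*factor ⟩
        sumTo n (λ k → raiseᵐₙ k + raiseᵏₙ k)                          ≈⟨ sumTo-distrib-+ n raiseᵐₙ raiseᵏₙ ⟩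
        sumTo n raiseᵐₙ + sumTo n raiseᵏₙ                              ≈⟨ sumTo-pascal n _ raiseᵐₙ raiseᵏₙ boundary-k≡0 middle last ⟨
        sumTo (suc n) (λ k → q ^ n * term (suc n ∸ k) k b) ≈⟨ *-distribˡ-sumTo (suc n) (q ^ n) _ ⟨
        q ^ n * sumTo (suc n) (λ k → term (suc n ∸ k) k b) ∎
        where
        middle : ∀ k → k ℕ.< n → q ^ n * term (n ∸ k) (suc k) b ≈ raiseᵐₙ (suc k) + raiseᵏₙ k
        middle k k<n = begin
          q ^ n * term (n ∸ k) (suc k) b                  ≡⟨ ≡.cong₂ (λ i j → q ^ i * term j (suc k) b) (≡.sym 1+m+k≡n) n∸k≡1+m ⟩
          q ^ suc (m ℕ.+ k) * term (suc m) (suc k) b      ≈⟨ interior m k 1+m+k≡n ⟩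
          raiseᵐ m (suc k) + raiseᵏ (suc m) k                     ≡⟨ ≡.cong (λ j → raiseᵐ m (suc k) + raiseᵏ j k) n∸k≡1+m ⟨
          raiseᵐₙ (suc k) + raiseᵏₙ k                                 ∎
          where
          m : ℕ
          m = n ∸ suc k
          n∸k≡1+m : n ∸ k ≡ suc m
          n∸k≡1+m = ℕ.+-∸-assoc 1 k<n
          1+m+k≡n : suc (m ℕ.+ k) ≡ n
          1+m+k≡n = ≡.trans (≡.cong (ℕ._+ k) (≡.sym n∸k≡1+m)) (ℕ.m∸n+n≡m (ℕ.<⇒≤ k<n))

        last : q ^ n * term (n ∸ n) (suc n) b ≈ raiseᵏₙ n
        last = begin
          q ^ n * term (n ∸ n) (suc n) b   ≡⟨ ≡.cong (λ j → q ^ n * term j (suc n) b) (ℕ.n∸n≡0 n) ⟩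
          q ^ n * term 0 (suc n) b         ≈⟨ boundary-m≡0 ⟩
          raiseᵏ 0 n                           ≡⟨ ≡.cong (λ j → raiseᵏ j n) (ℕ.n∸n≡0 n) ⟨
          raiseᵏₙ n                              ∎

      step : lhs n ≈ rhs n b′ → lhs (suc n) ≈ rhs (suc n) b
      step ih = begin
        lhs n * factor n                                   ≈⟨ *-congʳ ih ⟩
        q ^ (n C 2) * sumTo n (λ k → term (n ∸ k) k b′) * factor n ≈⟨ *-assoc _ _ _ ⟩
        q ^ (n C 2) * (sumTo n (λ k → term (n ∸ k) k b′) * factor n) ≈⟨ *-congˡ sum-step ⟩
        q ^ (n C 2) * (q ^ n * S)                           ≈⟨ *-assoc _ _ _ ⟨
        q ^ (n C 2) * q ^ n * S                             ≈⟨ *-congʳ (trans (*-comm _ _) (sym (^-distribˡ-+-* q n (n C 2)))) ⟩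
        q ^ (n ℕ.+ n C 2) * S                               ≡⟨ ≡.cong (λ j → q ^ j * S) [n+1]C2 ⟩
        q ^ (suc n C 2) * S                                 ∎
        where
        S : Carrier
        S = sumTo (suc n) (λ k → term (suc n ∸ k) k b)
        [n+1]C2 : n ℕ.+ n C 2 ≡ suc n C 2
        [n+1]C2 = ≡.trans (≡.cong (ℕ._+ n C 2) (≡.sym (nC1≡n n))) (nCk+nC[k+1]≡[n+1]C[k+1] n 1)

    expansion : ∀ n b → b ≉ 0# → Nondegenerate n b → lhs n ≈ rhs n b
    expansion zero    b b≉0 nd = sym (begin
      1# * (coeff 0 0 b * (1# * 1#) * (1# * 1#) * (1# * 1#) * (1# * 1#))
        ≈⟨ *-congˡ (*-congʳ (*-congʳ (*-congʳ (*-congʳ coeff₀₀≈1)))) ⟩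
      1# * (1# * (1# * 1#) * (1# * 1#) * (1# * 1#) * (1# * 1#))
        ≈⟨ solve 0 (con (+ 1) :* (con (+ 1) :* (con (+ 1) :* con (+ 1)) :* (con (+ 1) :* con (+ 1)) :* (con (+ 1) :* con (+ 1)) :* (con (+ 1) :* con (+ 1))) := con (+ 1)) refl ⟩
      1# ∎)
      where
      coeff₀₀≈1 : coeff 0 0 b ≈ 1#
      coeff₀₀≈1 = trans (*-cong (1/1≈1 refl (*-identityʳ 1#)) (1/1≈1 num₀₀≈1 den₀₀≈1)) (*-identityʳ 1#)
        where
        num₀₀≈1 : num 0 0 b ≈ 1#
        num₀₀≈1 = solve 0 (con (+ 1) :* con (+ 1) :* (con (+ 1) :* con (+ 1)) :* (con (+ 1) :* con (+ 1)) :* (con (+ 1) :* con (+ 1)) := con (+ 1)) refl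
        den₀₀≈1 : den 0 0 b ≈ 1#
        den₀₀≈1 = solve 0 (con (+ 1) :* con (+ 1) :* con (+ 1) :* con (+ 1) := con (+ 1)) refl
    expansion (suc n) b b≉0 nd = step (expansion n b′ b′≉0 nondegenerate′)
      where open Step n b b≉0 nd

[1+j]-1≡j : ∀ j → (+ suc j) -ℤ (+ 1) ≡ + j
[1+j]-1≡j j = ≡.trans (ℤ.[1+m]⊖[1+n]≡m⊖n j 0) (ℤ.⊖-≥ z≤n)

1-[1+j]≡-j : ∀ j → (+ 1) -ℤ (+ suc j) ≡ ℤ.- (+ j)
1-[1+j]≡-j j = ≡.trans (ℤ.[1+m]⊖[1+n]≡m⊖n 0 j) (ℤ.⊖-≤ z≤n)

[k+1]-[1+m+k]≡-m : ∀ m k → (+ (k ℕ.+ 1)) -ℤ (+ suc (m ℕ.+ k)) ≡ ℤ.- (+ m)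
[k+1]-[1+m+k]≡-m m zero    rewrite ℕ.+-identityʳ m = 1-[1+j]≡-j m
[k+1]-[1+m+k]≡-m m (suc k) rewrite ℕ.+-suc m k =
  ≡.trans (ℤ.[1+m]⊖[1+n]≡m⊖n (k ℕ.+ 1) (suc (m ℕ.+ k))) ([k+1]-[1+m+k]≡-m m k)

2[m+k]∸2k≡2m : ∀ m k → 2 ℕ.* (m ℕ.+ k) ∸ 2 ℕ.* k ≡ 2 ℕ.* m
2[m+k]∸2k≡2m m k = ≡.trans (≡.cong (_∸ 2 ℕ.* k) (ℕ.*-distribˡ-+ 2 m k)) (ℕ.m+n∸n≡m (2 ℕ.* m) (2 ℕ.* k))

module StatementForm {ℓ₁ ℓ₂ : Level} (F : Field ℓ₁ ℓ₂) (u y a b c q : Field.Carrier F) where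
  open Field F
  open FieldOps F
  open FieldProperties F
  open CauchyPolynomials F q
  open Expansion F u y a c q

  -- The summand of the statement, with the occurrences of n ∸ k and 2n ∸ 2k abstracted as d and t.
  summand : ℕ → ℕ → ℕ → ℕ → Carrier
  summand n d t k =
    qbinom q n k
    * ((P q d b (u * q ^ℤ ((+ n) -ℤ (+ 1))) * P q k a (u * q ^ d) * P q d u (c / b) * P q k (c / a) u)
       / (P q n b a * poch q (c * q ^ℤ ((+ d) -ℤ (+ 1)) / (a * b)) d * poch q (c * q ^ t / (a * b)) k))
    * P q d y (a * q ^ℤ ((+ (k ℕ.+ 1)) -ℤ (+ n)))
    * P q d y (c / a)
    * P q k y (b * q ^ℤ ((+ 1) -ℤ (+ n)))
    * P q k y (c * q ^ d / b)

  q^ℤ-j≈q^j⁻¹ : ∀ j → q ^ℤ (ℤ.- (+ j)) ≈ (q ^ j) ⁻¹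
  q^ℤ-j≈q^j⁻¹ zero    = sym 1⁻¹≈1
  q^ℤ-j≈q^j⁻¹ (suc j) = refl

  num₁≈ : ∀ m k → P q m b (u * q ^ℤ ((+ (m ℕ.+ k)) -ℤ (+ 1))) ≈ num₁ m k b
  num₁≈ zero    k = refl
  num₁≈ (suc m) k = reflexive (≡.cong (λ z → P q (suc m) b (u * q ^ℤ z)) ([1+j]-1≡j (m ℕ.+ k)))

  den₂≈ : ∀ m → poch q (c * q ^ℤ ((+ m) -ℤ (+ 1)) / (a * b)) m ≈ den₂ m b
  den₂≈ zero    = refl
  den₂≈ (suc m) = reflexive (≡.cong (λ z → poch q (c * q ^ℤ z / (a * b)) (suc m)) ([1+j]-1≡j m))

  Ya≈ : ∀ m k → P q m y (a * q ^ℤ ((+ (k ℕ.+ 1)) -ℤ (+ (m ℕ.+ k)))) ≈ Ya m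
  Ya≈ zero    k = refl
  Ya≈ (suc m) k = P-cong (suc m) refl (*-congˡ (trans (reflexive (≡.cong (q ^ℤ_) ([k+1]-[1+m+k]≡-m m k))) (q^ℤ-j≈q^j⁻¹ m)))

  Yb≈ : ∀ m k → P q k y (b * q ^ℤ ((+ 1) -ℤ (+ (m ℕ.+ k)))) ≈ Yb m k b
  Yb≈ m zero    = refl
  Yb≈ m (suc k) rewrite ℕ.+-suc m k =
    P-cong (suc k) refl (*-congˡ (trans (reflexive (≡.cong (q ^ℤ_) (1-[1+j]≡-j (m ℕ.+ k)))) (q^ℤ-j≈q^j⁻¹ (m ℕ.+ k))))

  summand≈term′ : ∀ m k → summand (m ℕ.+ k) m (2 ℕ.* m) k ≈ term m k b
  summand≈term′ m k =
    *-cong (*-cong (*-cong (*-cong (*-congˡ (*-cong (*-congʳ (*-congʳ (*-congʳ (num₁≈ m k))))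
                                                    (⁻¹-cong (*-congʳ (*-congˡ (den₂≈ m))))))
                                   (Ya≈ m k))
                           refl)
                   (Yb≈ m k))
           refl

  summand≈term : ∀ n k → k ≤ n → summand n (n ∸ k) (2 ℕ.* n ∸ 2 ℕ.* k) k ≈ term (n ∸ k) k b
  summand≈term n k k≤n = trans (reflexive (≡.cong₂ (λ j t → summand j (n ∸ k) t k) n≡m+k 2n∸2k≡2m)) (summand≈term′ (n ∸ k) k)
    where
    n≡m+k : n ≡ (n ∸ k) ℕ.+ k
    n≡m+k = ≡.sym (ℕ.m∸n+n≡m k≤n)
    2n∸2k≡2m : 2 ℕ.* n ∸ 2 ℕ.* k ≡ 2 ℕ.* (n ∸ k)
    2n∸2k≡2m = ≡.trans (≡.cong (λ j → 2 ℕ.* j ∸ 2 ℕ.* k) n≡m+k) (2[m+k]∸2k≡2m (n ∸ k) k)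

  nondegenerate : ∀ n →
    (∀ m → m ≤ n → poch q q m ≉ 0#) →
    P q n b a ≉ 0# →
    (∀ k → k ≤ n → poch q (c * q ^ℤ ((+ (n ∸ k)) -ℤ (+ 1)) / (a * b)) (n ∸ k) ≉ 0#) →
    (∀ k → k ≤ n → poch q (c * q ^ (2 ℕ.* n ∸ 2 ℕ.* k) / (a * b)) k ≉ 0#) →
    Nondegenerate n b
  nondegenerate n qfac≉0 den₁≉0 den₂′≉0 den₃′≉0 = record
    { qfac≉0 = qfac≉0
    ; den₁≉0 = den₁≉0
    ; den₂≉0 = den₂≉0
    ; den₃≉0 = den₃≉0
    }
    where
    den₂≉0 : ∀ m k → m ℕ.+ k ≡ n → den₂ m b ≉ 0#
    den₂≉0 m k ≡.refl = ≉0-resp-≈ (den₂≈ m)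
      (≡.subst (λ d → poch q (c * q ^ℤ ((+ d) -ℤ (+ 1)) / (a * b)) d ≉ 0#) (ℕ.m+n∸n≡m m k) (den₂′≉0 k (ℕ.m≤n+m k m)))
    den₃≉0 : ∀ m k → m ℕ.+ k ≡ n → den₃ m k b ≉ 0#
    den₃≉0 m k ≡.refl = ≡.subst (λ t → poch q (c * q ^ t / (a * b)) k ≉ 0#) (2[m+k]∸2k≡2m m k) (den₃′≉0 k (ℕ.m≤n+m k m))

corollary1p2 : ∀ {c ℓ : Level} (F : Field c ℓ) →
  let open FieldNotation F in
  (u y a b cc q : Carrier) (n : ℕ) →
  ¬ (u ≈ 0#) → ¬ (y ≈ 0#) → ¬ (a ≈ 0#) → ¬ (b ≈ 0#) → ¬ (cc ≈ 0#) → ¬ (q ≈ 0#) →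
  (∀ m → m ≤ n → ¬ (poch q q m ≈ 0#)) →
  ¬ (P q n b a ≈ 0#) →
  (∀ k → k ≤ n → ¬ (poch q (cc * q ^ℤ ((+ (n ∸ k)) -ℤ (+ 1)) / (a * b)) (n ∸ k) ≈ 0#)) →
  (∀ k → k ≤ n → ¬ (poch q (cc * q ^ (2 *ℕ n ∸ 2 *ℕ k) / (a * b)) k ≈ 0#)) →
  prod1To n (λ i → (u * q ^ (i ∸ 1) - y) * (cc - u * q ^ (i ∸ 1) * y))
  ≈
  q ^ (n C 2) * sumTo n (λ k →
    qbinom q n k
    * ((P q (n ∸ k) b (u * q ^ℤ ((+ n) -ℤ (+ 1)))
        * P q k a (u * q ^ (n ∸ k))
        * P q (n ∸ k) u (cc / b)
        * P q k (cc / a) u)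
       / (P q n b a
          * poch q (cc * q ^ℤ ((+ (n ∸ k)) -ℤ (+ 1)) / (a * b)) (n ∸ k)
          * poch q (cc * q ^ (2 *ℕ n ∸ 2 *ℕ k) / (a * b)) k))
    * P q (n ∸ k) y (a * q ^ℤ ((+ (k +ℕ 1)) -ℤ (+ n)))
    * P q (n ∸ k) y (cc / a)
    * P q k y (b * q ^ℤ ((+ 1) -ℤ (+ n)))
    * P q k y (cc * q ^ (n ∸ k) / b))
corollary1p2 F u y a b cc q n u≉0 y≉0 a≉0 b≉0 c≉0 q≉0 qfac≉0 den₁≉0 den₂≉0 den₃≉0 = begin
  lhs n                                                           ≈⟨ expansion u≉0 y≉0 a≉0 c≉0 q≉0 n b b≉0 nd ⟩
  rhs n b                                                         ≈⟨ *-congˡ (sumTo-cong n (λ k k≤n → sym (summand≈term n k k≤n))) ⟩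
  q ^ (n C 2) * sumTo n (λ k → summand n (n ∸ k) (2 ℕ.* n ∸ 2 ℕ.* k) k) ∎
  where
  open Field F
  open FieldOps F
  open FieldProperties F
  open Expansion F u y a cc q
  open StatementForm F u y a b cc q
  open import Relation.Binary.Reasoning.Setoid setoid
  nd : Nondegenerate n b
  nd = nondegenerate n qfac≉0 den₁≉0 den₂≉0 den₃≉0
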